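{- Let $G=G_1\nabla^2 G_2$ be a Haj\'os $2$-join of two disjoint non-empty graphs $G_1$ and $G_2$. Then: (a) if $\chi_2(G_1)=\chi_2(G_2)=k$ and $k\ge3$, then $\chi_2(G)=k$; (b) if both $G_1$ and $G_2$ belong to ${\rm Cri}_2(k)$ and $k\ge3$, then $G$ belongs to ${\rm Cri}_2(k)$.
   Context: All graphs are finite, undirected, loopless, and may have multiple edges. Hajós $2$-join: let $G_1,G_2$ be disjoint graphs and for $i\in\{1,2\}$ let $u_i,v_i$ be distinct vertices of $G_i$ and $E_i$ a set of two edges of $G_i$ joining $u_i$ and $v_i$. The graph $G_1\nabla^2 G_2$ is obtained from $G_1\cup G_2$ by deleting $E_1$ and $E_2$, identifying $v_1$ with $v_2$, and adding two new parallel edges between $u_1$ and $u_2$. $\chi_2(G)$ is the least $k\ge0$ such that $V(G)$ can be colored with $k$ colors so that each color class induces a forest (two parallel edges form a cycle). $G$ is $\chi_2$-critical if $\chi_2(G')<\chi_2(G)$ for every proper subgraph $G'$; ${\rm Cri}_2(k)$ is the class of $\chi_2$-critical graphs with $\chi_2=k$. -}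

module Defs where

open import Data.Nat using (ℕ; zero; suc; _≤_; _<_)
open import Data.Fin using (Fin; inject₁; fromℕ) renaming (zero to fzero; suc to fsuc)
open import Data.Bool using (Bool; true; false)
open import Data.Product using (Σ; _×_; _,_; proj₁; proj₂; ∃)
open import Data.Sum using (_⊎_; inj₁; inj₂)
open import Function.Bundles using (_↔_)
open import Function.Definitions using (Injective)
open import Relation.Binary.PropositionalEquality using (_≡_; _≢_)
open import Relation.Binary.Definitions using (DecidableEquality)
open import Relation.Nullary using (¬_; Dec; yes; no)
open import Relation.Nullary.Decidable using (False; fromWitnessFalse)

-- Multigraphs: a vertex type, an edge type, and for each edge its two
-- ends (stored as an ordered pair; edges are undirected, see Joins).

record Graph : Set₁ where
  field
    V    : Set
    E    : Set
    ends : E → V × V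

open Graph public

Joins : (G : Graph) → E G → V G → V G → Set
Joins G e x y = (ends G e ≡ (x , y)) ⊎ (ends G e ≡ (y , x))

Finite : Graph → Set
Finite G = (Σ ℕ λ n → V G ↔ Fin n) × (Σ ℕ λ m → E G ↔ Fin m)

Loopless : Graph → Set
Loopless G = ∀ e → proj₁ (ends G e) ≢ proj₂ (ends G e)

VSub : Graph → Set
VSub G = V G → Bool

ESub : Graph → Set
ESub G = E G → Bool

IsSubgraph : (G : Graph) → VSub G → ESub G → Set
IsSubgraph G S F = ∀ e → F e ≡ true →
  (S (proj₁ (ends G e)) ≡ true) × (S (proj₂ (ends G e)) ≡ true)

IsProper : (G : Graph) → VSub G → ESub G → Set
IsProper G S F = (∃ λ v → S v ≡ false) ⊎ (∃ λ e → F e ≡ false)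

allV : (G : Graph) → VSub G
allV G _ = true

allE : (G : Graph) → ESub G
allE G _ = true

-- A cycle of length (suc l), l ≥ 1 (so length ≥ 2), consists of
-- pairwise distinct vertices vs 0 … vs l and pairwise distinct edges
-- es 0 … es l with es i joining vs i and vs (i+1), and es l joining
-- vs l and vs 0.  Length 2 = two parallel edges.

record Cycle (G : Graph) : Set where
  field
    l       : ℕ
    l≥1     : 1 ≤ l
    vs      : Fin (suc l) → V G
    es      : Fin (suc l) → E G
    vs-inj  : Injective _≡_ _≡_ vs
    es-inj  : Injective _≡_ _≡_ es
    step    : (i : Fin l) → Joins G (es (inject₁ i)) (vs (inject₁ i)) (vs (fsuc i))
    close   : Joins G (es (fromℕ l)) (vs (fromℕ l)) (vs fzero)

open Cycle public

InSub : (G : Graph) → VSub G → ESub G → Cycle G → Set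
InSub G S F C = (∀ i → S (vs C i) ≡ true) × (∀ i → F (es C i) ≡ true)

-- χ₂: colourings of the vertices of the subgraph (S , F) with k colours
-- such that every colour class induces a forest, i.e. no cycle of the
-- subgraph has all of its vertices in one colour class.

Colouring : (G : Graph) → VSub G → ℕ → Set
Colouring G S k = (v : V G) → S v ≡ true → Fin k

ForestColouring : (G : Graph) (S : VSub G) (F : ESub G) (k : ℕ) → Colouring G S k → Set
ForestColouring G S F k c =
  (C : Cycle G) (p : InSub G S F C) →
  ¬ (∀ i → c (vs C i) (proj₁ p i) ≡ c (vs C fzero) (proj₁ p fzero))

Colourable : (G : Graph) → VSub G → ESub G → ℕ → Set
Colourable G S F k = Σ (Colouring G S k) (ForestColouring G S F k)

IsChi₂Sub : (G : Graph) → VSub G → ESub G → ℕ → Set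
IsChi₂Sub G S F k = Colourable G S F k × (∀ j → Colourable G S F j → k ≤ j)

IsChi₂ : Graph → ℕ → Set
IsChi₂ G k = IsChi₂Sub G (allV G) (allE G) k

Cri₂ : Graph → ℕ → Set
Cri₂ G k = IsChi₂ G k ×
  ((S : VSub G) (F : ESub G) → IsSubgraph G S F → IsProper G S F →
     Σ ℕ λ j → IsChi₂Sub G S F j × j < k)

-- Vertices: V G₁ together with the vertices of G₂ other
-- than v₂ (v₂ is identified with v₁).  Edges: edges of G₁ except e₁,e₁',
-- edges of G₂ except e₂,e₂', and two new parallel edges u₁u₂.

module HajosJoin (G₁ G₂ : Graph)
                 (_≟V₂_ : DecidableEquality (V G₂))
                 (_≟E₁_ : DecidableEquality (E G₁))
                 (_≟E₂_ : DecidableEquality (E G₂))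
                 (u₁ v₁ : V G₁) (e₁ e₁' : E G₁)
                 (u₂ v₂ : V G₂) (e₂ e₂' : E G₂) where

  JV : Set
  JV = V G₁ ⊎ Σ (V G₂) (λ x → False (x ≟V₂ v₂))

  JE : Set
  JE = (Σ (E G₁) (λ e → False (e ≟E₁ e₁) × False (e ≟E₁ e₁')))
     ⊎ (Σ (E G₂) (λ e → False (e ≟E₂ e₂) × False (e ≟E₂ e₂')))
     ⊎ Bool

  ι₂' : (x : V G₂) → Dec (x ≡ v₂) → JV
  ι₂' x (yes _) = inj₁ v₁
  ι₂' x (no ¬p) = inj₂ (x , fromWitnessFalse ¬p)

  ι₂ : V G₂ → JV
  ι₂ x = ι₂' x (x ≟V₂ v₂)

  jends : JE → JV × JV
  jends (inj₁ (e , _)) = inj₁ (proj₁ (ends G₁ e)) , inj₁ (proj₂ (ends G₁ e))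
  jends (inj₂ (inj₁ (e , _))) = ι₂ (proj₁ (ends G₂ e)) , ι₂ (proj₂ (ends G₂ e))
  jends (inj₂ (inj₂ _)) = inj₁ u₁ , ι₂ u₂

  join : Graph
  join = record { V = JV ; E = JE ; ends = jends }

{-# OPTIONS --safe #-}

-- Colourings of G₁ − {e₁, e₁′} and of G₂ − {e₂, e₂′} glue along v₁ = v₂ to a colouring of the
-- join: a monochromatic cycle avoiding the new edges u₁u₂ would have to change between the
-- G₁- and the G₂-part twice, but it can only do so at v₁, which it passes at most once.
-- (a) With k ≥ 3 colours, permute the colours of G₂ so that v₂ matches v₁ and u₂ differs from
-- u₁; then the new edges lie on no monochromatic cycle. Conversely, in a colouring of the join
-- either u₁, v₁ (or u₂, v₂) get different colours, so e₁, e₁′ (or e₂, e₂′) can be put back and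
-- G₁ (or G₂) is coloured, or u₁, v₁ = v₂, u₂ share a colour and the new edges form a
-- monochromatic digon.
-- (b) A proper subgraph H of the join misses a vertex or an edge. Delete the corresponding
-- element from G₁ (say) and e₂, e₂′ from G₂; by criticality both become (k − 1)-colourable, and
-- in G₂ − {e₂, e₂′} the colours of u₂ and v₂ are forced to agree, which keeps the surviving new
-- edges harmless. If H misses a new edge, delete only e₁ from G₁ instead: a monochromatic cycle
-- through the other new edge contains a path of G₁ − e₁ from v₁ to u₁, which closes up with e₁′.
-- The exact χ₂(H) is then found by exhaustive search over colourings.
module Submission where

open import Defs
open import Axiom.UniquenessOfIdentityProofs.WithK using (uip)
open import Data.Bool using (Bool; true; false)
import Data.Bool.Properties as Boolₚ
open import Data.Empty using (⊥; ⊥-elim)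
open import Data.Fin using (Fin; toℕ; fromℕ<; inject₁; fromℕ; inject≤) renaming (zero to fzero; suc to fsuc)
open import Data.Fin.Permutation.Components using (transpose; transpose-inverse)
import Data.Fin.Properties as Finₚ
open import Data.Nat using (ℕ; zero; suc; _+_; _∸_; _≤_; _<_; z≤n; s≤s; _<?_; _≤?_)
open import Data.Nat.Properties hiding (_≟_)
open import Data.Product using (Σ-syntax; ∃; ∃-syntax; _×_; _,_; proj₁; proj₂)
open import Data.Product.Properties using (,-injectiveˡ; ,-injectiveʳ; ≡-dec)
open import Data.Sum using (_⊎_; inj₁; inj₂; [_,_])
open import Data.Sum.Function.Propositional using (_⊎-↩_)
open import Data.Sum.Properties using (inj₁-injective)
open import Data.Vec.Functional using (_∷_; head; tail)
open import Function using (_∘_)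
open import Function.Bundles using (_↔_; _↩_; LeftInverse; mk↩)
open import Function.Construct.Composition using (_↩-∘_)
open import Function.Definitions using (Injective)
open import Function.Properties.Inverse using (↔-sym; ↔⇒↩)
open import Relation.Binary.Definitions using (DecidableEquality)
open import Relation.Binary.PropositionalEquality using (_≡_; _≢_; refl; sym; trans; cong; cong₂; subst; subst₂)
open import Relation.Nullary using (¬_; Dec; yes; no; does; contradiction)
open import Relation.Nullary.Decidable
  using (_⊎-dec_; _×-dec_; _→-dec_; ¬?; map′; dec-true; dec-false; False; toWitnessFalse; fromWitnessFalse)
open import Relation.Unary using (Decidable)

Joins-sym : ∀ {G e x y} → Joins G e x y → Joins G e y x
Joins-sym (inj₁ p) = inj₂ p
Joins-sym (inj₂ p) = inj₁ p

Joins-ends : ∀ {G e x y x′ y′} → Joins G e x y → Joins G e x′ y′ →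
             (x ≡ x′ × y ≡ y′) ⊎ (x ≡ y′ × y ≡ x′)
Joins-ends (inj₁ p) (inj₁ q) = inj₁ (,-injectiveˡ (trans (sym p) q) , ,-injectiveʳ (trans (sym p) q))
Joins-ends (inj₁ p) (inj₂ q) = inj₂ (,-injectiveˡ (trans (sym p) q) , ,-injectiveʳ (trans (sym p) q))
Joins-ends (inj₂ p) (inj₁ q) = inj₂ (,-injectiveʳ (trans (sym p) q) , ,-injectiveˡ (trans (sym p) q))
Joins-ends (inj₂ p) (inj₂ q) = inj₁ (,-injectiveʳ (trans (sym p) q) , ,-injectiveˡ (trans (sym p) q))

Joins-map : ∀ {X Y e e′} (φ : V X → V Y) → ends Y e′ ≡ (φ (proj₁ (ends X e)) , φ (proj₂ (ends X e))) →
            ∀ {x y} → Joins X e x y → Joins Y e′ (φ x) (φ y)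
Joins-map φ eq (inj₁ refl) = inj₁ eq
Joins-map φ eq (inj₂ refl) = inj₂ eq

-- Circuits: cycles indexed by ℕ rather than Fin, so that index arithmetic stays in ℕ;
-- entries beyond len are junk.

record Circuit (G : Graph) : Set where
  field
    len              : ℕ
    len≥1            : 1 ≤ len
    vertex           : ℕ → V G
    edge             : ℕ → E G
    vertex-injective : ∀ {i j} → i ≤ len → j ≤ len → vertex i ≡ vertex j → i ≡ j
    edge-injective   : ∀ {i j} → i ≤ len → j ≤ len → edge i ≡ edge j → i ≡ j
    step             : ∀ {k} → k < len → Joins G (edge k) (vertex k) (vertex (suc k))
    close            : Joins G (edge len) (vertex len) (vertex 0)

open Circuit public

next : ℕ → ℕ → ℕ
next l k with k <? l
... | yes _ = suc k
... | no _  = 0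

next-< : ∀ {l k} → k < l → next l k ≡ suc k
next-< {l} {k} k<l with k <? l
... | yes _  = refl
... | no k≮l = contradiction k<l k≮l

next-last : ∀ l → next l l ≡ 0
next-last l with l <? l
... | yes l<l = contradiction l<l (<-irrefl refl)
... | no _    = refl

next-≤ : ∀ {l k} → k ≤ l → next l k ≤ l
next-≤ {l} {k} _ with k <? l
... | yes k<l = k<l
... | no _    = z≤n

next-injective : ∀ {l i j} → i ≤ l → j ≤ l → next l i ≡ next l j → i ≡ j
next-injective {l} i≤l j≤l eq with m≤n⇒m<n∨m≡n i≤l | m≤n⇒m<n∨m≡n j≤l
... | inj₁ i<l  | inj₁ j<l  = suc-injective (trans (sym (next-< i<l)) (trans eq (next-< j<l)))
... | inj₁ i<l  | inj₂ refl = contradiction (trans (sym (next-< i<l)) (trans eq (next-last l))) λ ()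
... | inj₂ refl | inj₁ j<l  = contradiction (trans (sym (next-last l)) (trans eq (next-< j<l))) λ ()
... | inj₂ refl | inj₂ refl = refl

step↻ : ∀ {G} (C : Circuit G) {k} → k ≤ len C →
        Joins G (edge C k) (vertex C k) (vertex C (next (len C) k))
step↻ C k≤l with m≤n⇒m<n∨m≡n k≤l
... | inj₁ k<l  rewrite next-< k<l       = step C k<l
... | inj₂ refl rewrite next-last (len C) = close C

record MonoCircuit (G : Graph) (S : VSub G) (F : ESub G) {j : ℕ} (f : V G → Fin j) : Set where
  field
    circuit       : Circuit G
    vertices-in   : ∀ {k} → k ≤ len circuit → S (vertex circuit k) ≡ true
    edges-in      : ∀ {k} → k ≤ len circuit → F (edge circuit k) ≡ true
    monochromatic : ∀ {k} → k ≤ len circuit → f (vertex circuit k) ≡ f (vertex circuit 0)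

open MonoCircuit public

-- Forest colourings in the sense of Defs, but total: f also colours the
-- vertices outside S.
IsForestColouring : (G : Graph) → VSub G → ESub G → {j : ℕ} → (V G → Fin j) → Set
IsForestColouring G S F f = ¬ MonoCircuit G S F f

private
  clamp : (l n : ℕ) → Fin (suc l)
  clamp l n with n <? suc l
  ... | yes n<1+l = fromℕ< n<1+l
  ... | no _      = fzero

  toℕ-clamp : ∀ {l n} → n ≤ l → toℕ (clamp l n) ≡ n
  toℕ-clamp {l} {n} n≤l with n <? suc l
  ... | yes n<1+l = Finₚ.toℕ-fromℕ< n<1+l
  ... | no n≮1+l  = contradiction (s≤s n≤l) n≮1+l

  toℕ≤ : ∀ {l} (i : Fin (suc l)) → toℕ i ≤ l
  toℕ≤ i = ≤-pred (Finₚ.toℕ<n i)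

  clamp-at : ∀ {l n} (i : Fin (suc l)) → toℕ i ≡ n → clamp l n ≡ i
  clamp-at i refl = Finₚ.toℕ-injective (toℕ-clamp (toℕ≤ i))

Cycle⇒Circuit : ∀ {G} → Cycle G → Circuit G
Cycle⇒Circuit {G} C = record
  { len              = l C
  ; len≥1            = l≥1 C
  ; vertex           = vs C ∘ clamp (l C)
  ; edge             = es C ∘ clamp (l C)
  ; vertex-injective = λ i≤l j≤l → clamp-injective i≤l j≤l ∘ vs-inj C
  ; edge-injective   = λ i≤l j≤l → clamp-injective i≤l j≤l ∘ es-inj C
  ; step             = step′
  ; close            = close′
  }
  where
  clamp-injective : ∀ {i j} → i ≤ l C → j ≤ l C → clamp (l C) i ≡ clamp (l C) j → i ≡ j
  clamp-injective i≤l j≤l eq = trans (sym (toℕ-clamp i≤l)) (trans (cong toℕ eq) (toℕ-clamp j≤l))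

  step′ : ∀ {k} → k < l C → Joins G (es C (clamp (l C) k)) (vs C (clamp (l C) k)) (vs C (clamp (l C) (suc k)))
  step′ k<l
    rewrite clamp-at (inject₁ (fromℕ< k<l)) (trans (Finₚ.toℕ-inject₁ _) (Finₚ.toℕ-fromℕ< k<l))
          | clamp-at (fsuc (fromℕ< k<l)) (cong suc (Finₚ.toℕ-fromℕ< k<l))
          = step C (fromℕ< k<l)

  close′ : Joins G (es C (clamp (l C) (l C))) (vs C (clamp (l C) (l C))) (vs C (clamp (l C) 0))
  close′ rewrite clamp-at (fromℕ (l C)) (Finₚ.toℕ-fromℕ (l C)) | clamp-at {l C} fzero refl = close C

Circuit⇒Cycle : ∀ {G} → Circuit G → Cycle G
Circuit⇒Cycle {G} C = record
  { l      = len C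
  ; l≥1    = len≥1 C
  ; vs     = vertex C ∘ toℕ
  ; es     = edge C ∘ toℕ
  ; vs-inj = λ {i} {j} eq → Finₚ.toℕ-injective (vertex-injective C (toℕ≤ i) (toℕ≤ j) eq)
  ; es-inj = λ {i} {j} eq → Finₚ.toℕ-injective (edge-injective C (toℕ≤ i) (toℕ≤ j) eq)
  ; step   = step′
  ; close  = close′
  }
  where
  step′ : (i : Fin (len C)) →
          Joins G (edge C (toℕ (inject₁ i))) (vertex C (toℕ (inject₁ i))) (vertex C (suc (toℕ i)))
  step′ i rewrite Finₚ.toℕ-inject₁ i = step C (Finₚ.toℕ<n i)

  close′ : Joins G (edge C (toℕ (fromℕ (len C)))) (vertex C (toℕ (fromℕ (len C)))) (vertex C 0)
  close′ rewrite Finₚ.toℕ-fromℕ (len C) = close C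

isForestColouring : ∀ {G S F j j′} {c : Colouring G S j} → ForestColouring G S F j c →
                    {f : V G → Fin j′} (π : Fin j → Fin j′) → Injective _≡_ _≡_ π →
                    (∀ v p → f v ≡ π (c v p)) → IsForestColouring G S F f
isForestColouring fc π π-inj f≗πc M =
  fc (Circuit⇒Cycle (circuit M)) (vertices-in M ∘ toℕ≤ , edges-in M ∘ toℕ≤)
     (λ i → π-inj (trans (sym (f≗πc _ _)) (trans (monochromatic M (toℕ≤ i)) (f≗πc _ _))))

forestColouring : ∀ {G S F j} {f : V G → Fin j} → IsForestColouring G S F f →
                  ForestColouring G S F j (λ v _ → f v)
forestColouring {f = f} tf C (inS , inF) mono = tf record
  { circuit       = Cycle⇒Circuit C
  ; vertices-in   = λ _ → inS _
  ; edges-in      = λ _ → inF _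
  ; monochromatic = λ _ → trans (mono _) (cong (f ∘ vs C) (sym (clamp-at fzero refl)))
  }

colourable : ∀ {G S F j} {f : V G → Fin j} → IsForestColouring G S F f → Colourable G S F j
colourable {f = f} tf = (λ v _ → f v) , forestColouring tf

totalColouring : ∀ {G F j} → Colourable G (allV G) F j → Σ[ f ∈ (V G → Fin j) ] IsForestColouring G (allV G) F f
totalColouring (c , fc) =
  (λ v → c v refl) , isForestColouring fc (λ i → i) (λ eq → eq) (λ v p → cong (c v) (uip refl p))

totalColouring≤ : ∀ {G S F j j′} → Colourable G S F j → j ≤ suc j′ →
                  Σ[ f ∈ (V G → Fin (suc j′)) ] IsForestColouring G S F f
totalColouring≤ {G} {S} {F} {j} {j′} (c , fc) j≤ =
  f , isForestColouring fc (λ i → inject≤ i j≤) (Finₚ.inject≤-injective j≤ j≤ _ _) agrees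
  where
  f′ : ∀ v b → S v ≡ b → Fin (suc j′)
  f′ v true  Sv = inject≤ (c v Sv) j≤
  f′ v false _  = fzero

  f : V G → Fin (suc j′)
  f v = f′ v (S v) refl

  agrees′ : ∀ v b (Sv≡b : S v ≡ b) (p : S v ≡ true) → f′ v b Sv≡b ≡ inject≤ (c v p) j≤
  agrees′ v true  Sv≡b p = cong (λ q → inject≤ (c v q) j≤) (uip Sv≡b p)
  agrees′ v false Sv≡b p = contradiction (trans (sym Sv≡b) p) λ ()

  agrees : ∀ v p → f v ≡ inject≤ (c v p) j≤
  agrees v = agrees′ v (S v) refl

map-circuit : ∀ {X Y} (C : Circuit X) (φ : V X → V Y) (ψ : E X → E Y) →
              (∀ {i j} → i ≤ len C → j ≤ len C → φ (vertex C i) ≡ φ (vertex C j) → vertex C i ≡ vertex C j) →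
              (∀ {i j} → i ≤ len C → j ≤ len C → ψ (edge C i) ≡ ψ (edge C j) → edge C i ≡ edge C j) →
              (∀ {k x y} → k ≤ len C → Joins X (edge C k) x y → Joins Y (ψ (edge C k)) (φ x) (φ y)) →
              Circuit Y
map-circuit C φ ψ φ-injective ψ-injective ψ-joins = record
  { len              = len C
  ; len≥1            = len≥1 C
  ; vertex           = φ ∘ vertex C
  ; edge             = ψ ∘ edge C
  ; vertex-injective = λ i≤l j≤l → vertex-injective C i≤l j≤l ∘ φ-injective i≤l j≤l
  ; edge-injective   = λ i≤l j≤l → edge-injective C i≤l j≤l ∘ ψ-injective i≤l j≤l
  ; step             = λ k<l → ψ-joins (<⇒≤ k<l) (step C k<l)
  ; close            = ψ-joins ≤-refl (close C)
  }

module _ {X : Graph} {S : VSub X} {F : ESub X} {j : ℕ} {f : V X → Fin j} where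

  recolour : IsForestColouring X S F f → {g : V X → Fin j} → (∀ v → S v ≡ true → g v ≡ f v) →
             IsForestColouring X S F g
  recolour tf g≗f M = tf record
    { circuit       = circuit M
    ; vertices-in   = vertices-in M
    ; edges-in      = edges-in M
    ; monochromatic = λ k≤l → trans (sym (g≗f _ (vertices-in M k≤l)))
                                    (trans (monochromatic M k≤l) (g≗f _ (vertices-in M z≤n)))
    }

  relabel : IsForestColouring X S F f → {j′ : ℕ} {π : Fin j → Fin j′} → Injective _≡_ _≡_ π →
            IsForestColouring X S F (π ∘ f)
  relabel tf π-inj M = tf record
    { circuit       = circuit M
    ; vertices-in   = vertices-in M
    ; edges-in      = edges-in M
    ; monochromatic = π-inj ∘ monochromatic M
    }

  rotate : MonoCircuit X S F f → MonoCircuit X S F f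
  rotate M = record
    { circuit       = record
      { len              = n
      ; len≥1            = len≥1 C
      ; vertex           = vertex C ∘ next n
      ; edge             = edge C ∘ next n
      ; vertex-injective = λ i≤n j≤n → next-injective i≤n j≤n ∘ vertex-injective C (next-≤ i≤n) (next-≤ j≤n)
      ; edge-injective   = λ i≤n j≤n → next-injective i≤n j≤n ∘ edge-injective C (next-≤ i≤n) (next-≤ j≤n)
      ; step             = step′
      ; close            = close′
      }
    ; vertices-in   = vertices-in M ∘ next-≤
    ; edges-in      = edges-in M ∘ next-≤
    ; monochromatic = λ k≤n → trans (monochromatic M (next-≤ k≤n)) (sym (monochromatic M (next-≤ z≤n)))
    }
    where
    C = circuit M
    n = len C

    step′ : ∀ {k} → k < n → Joins X (edge C (next n k)) (vertex C (next n k)) (vertex C (next n (suc k)))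
    step′ k<n rewrite next-< k<n = step↻ C k<n

    close′ : Joins X (edge C (next n n)) (vertex C (next n n)) (vertex C (next n 0))
    close′ rewrite next-last n = step↻ C z≤n

  rotate-to-end : (M : MonoCircuit X S F f) {k : ℕ} → k ≤ len (circuit M) →
                  Σ[ M′ ∈ MonoCircuit X S F f ] edge (circuit M′) (len (circuit M′)) ≡ edge (circuit M) k
  rotate-to-end M {zero} _ = rotate M , cong (edge (circuit M)) (next-last (len (circuit M)))
  rotate-to-end M {suc k} k<l with rotate-to-end (rotate M) (<⇒≤ k<l)
  ... | M′ , last≡ = M′ , trans last≡ (cong (edge (circuit M)) (next-< k<l))

private
  pair : {A : Set} → A → A → ℕ → A
  pair p q zero    = p
  pair p q (suc _) = q

  pair-injective : ∀ {A : Set} {p q : A} → p ≢ q →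
                   ∀ {i j} → i ≤ 1 → j ≤ 1 → pair p q i ≡ pair p q j → i ≡ j
  pair-injective p≢q {zero}  {zero}  _         _         _  = refl
  pair-injective p≢q {zero}  {suc _} _         _         eq = contradiction eq p≢q
  pair-injective p≢q {suc _} {zero}  _         _         eq = contradiction (sym eq) p≢q
  pair-injective p≢q {suc _} {suc _} (s≤s z≤n) (s≤s z≤n) _  = refl

digon : ∀ {X x y a a′} → x ≢ y → a ≢ a′ → Joins X a x y → Joins X a′ x y → Circuit X
digon {X} {x} {y} {a} {a′} x≢y a≢a′ a-joins a′-joins = record
  { len              = 1
  ; len≥1            = ≤-refl
  ; vertex           = pair x y
  ; edge             = pair a a′
  ; vertex-injective = pair-injective x≢y
  ; edge-injective   = pair-injective a≢a′
  ; step             = λ { {zero} _ → a-joins ; {suc _} (s≤s ()) }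
  ; close            = Joins-sym {X} a′-joins
  }

module _ {X : Graph} {S : VSub X} {j : ℕ} {f : V X → Fin j} {x y : V X} {a a′ : E X}
         (a-joins : Joins X a x y) (a′-joins : Joins X a′ x y) where

  parallel-ends-differ : ∀ {F} → IsForestColouring X S F f → x ≢ y → a ≢ a′ →
                         S x ≡ true → S y ≡ true → F a ≡ true → F a′ ≡ true → f x ≢ f y
  parallel-ends-differ tf x≢y a≢a′ Sx Sy Fa Fa′ fx≡fy = tf record
    { circuit       = digon x≢y a≢a′ a-joins a′-joins
    ; vertices-in   = λ { {zero} _ → Sx ; {suc _} _ → Sy }
    ; edges-in      = λ { {zero} _ → Fa ; {suc _} _ → Fa′ }
    ; monochromatic = λ { {zero} _ → refl ; {suc _} _ → sym fx≡fy }
    }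

  -- A monochromatic circuit through a or a′ would colour x and y alike.
  add-parallel-edges : DecidableEquality (E X) → ∀ {F F′} → IsForestColouring X S F f →
                       (∀ e → F′ e ≡ true → e ≢ a → e ≢ a′ → F e ≡ true) → f x ≢ f y →
                       IsForestColouring X S F′ f
  add-parallel-edges _≟_ {F} tf F′⊆F fx≢fy M
    with anyUpTo? (λ k → (edge C k ≟ a) ⊎-dec (edge C k ≟ a′)) (suc (len C))
    where C = circuit M
  ... | yes (k , k<1+l , parallel) = fx≢fy (colours-agree (Joins-ends {X} (step↻ C k≤l) (x-y-joined parallel)))
    where
    C = circuit M
    k≤l = ≤-pred k<1+l

    x-y-joined : (edge C k ≡ a) ⊎ (edge C k ≡ a′) → Joins X (edge C k) x y
    x-y-joined (inj₁ refl) = a-joins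
    x-y-joined (inj₂ refl) = a′-joins

    colours-agree : _ → f x ≡ f y
    colours-agree (inj₁ (refl , refl)) = trans (monochromatic M k≤l) (sym (monochromatic M (next-≤ k≤l)))
    colours-agree (inj₂ (refl , refl)) = trans (monochromatic M (next-≤ k≤l)) (sym (monochromatic M k≤l))
  ... | no avoids = tf record
    { circuit       = circuit M
    ; vertices-in   = vertices-in M
    ; edges-in      = λ k≤l → F′⊆F _ (edges-in M k≤l) (λ eq → avoids (_ , s≤s k≤l , inj₁ eq))
                                                      (λ eq → avoids (_ , s≤s k≤l , inj₂ eq))
    ; monochromatic = monochromatic M
    }

private
  transpose-injective : ∀ {n} (i j : Fin n) → Injective _≡_ _≡_ (transpose i j)
  transpose-injective i j {x} {y} eq =
    trans (sym (transpose-inverse j i)) (trans (cong (transpose j i) eq) (transpose-inverse j i))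

  transpose-sends : ∀ {n} (i j : Fin n) → transpose i j i ≡ j
  transpose-sends i j rewrite dec-true (i Finₚ.≟ i) refl = refl

  transpose-fixes : ∀ {n} {i j k : Fin n} → k ≢ i → k ≢ j → transpose i j k ≡ k
  transpose-fixes {i = i} {j} {k} k≢i k≢j
    rewrite dec-false (k Finₚ.≟ i) k≢i | dec-false (k Finₚ.≟ j) k≢j = refl

  colour-other-than : ∀ {n} → 2 ≤ n → (x : Fin n) → ∃[ t ] t ≢ x
  colour-other-than (s≤s (s≤s _)) fzero    = fsuc fzero , λ ()
  colour-other-than (s≤s (s≤s _)) (fsuc _) = fzero , λ ()

  colour-other-than-both : ∀ {n} → 3 ≤ n → (x y : Fin n) → ∃[ t ] t ≢ x × t ≢ y
  colour-other-than-both (s≤s (s≤s (s≤s _))) fzero fzero               = fsuc fzero , (λ ()) , (λ ())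
  colour-other-than-both (s≤s (s≤s (s≤s _))) fzero (fsuc fzero)        = fsuc (fsuc fzero) , (λ ()) , (λ ())
  colour-other-than-both (s≤s (s≤s (s≤s _))) fzero (fsuc (fsuc _))     = fsuc fzero , (λ ()) , (λ ())
  colour-other-than-both (s≤s (s≤s (s≤s _))) (fsuc fzero) fzero        = fsuc (fsuc fzero) , (λ ()) , (λ ())
  colour-other-than-both (s≤s (s≤s (s≤s _))) (fsuc (fsuc _)) fzero     = fsuc fzero , (λ ()) , (λ ())
  colour-other-than-both (s≤s (s≤s (s≤s _))) (fsuc _) (fsuc _)         = fzero , (λ ()) , (λ ())

relabelling-sending : ∀ {n} (y y′ : Fin n) → ∃[ π ] Injective _≡_ _≡_ π × π y ≡ y′
relabelling-sending y y′ = transpose y y′ , transpose-injective y y′ , transpose-sends y y′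

relabelling-avoiding : ∀ {n} → 2 ≤ n → (x x′ : Fin n) → ∃[ π ] Injective _≡_ _≡_ π × π x ≢ x′
relabelling-avoiding 2≤n x x′ with colour-other-than 2≤n x′
... | t , t≢x′ with relabelling-sending x t
...   | π , π-inj , πx≡t = π , π-inj , λ πx≡x′ → t≢x′ (trans (sym πx≡t) πx≡x′)

-- First send y to y′, then move the image of x to a third colour t, which fixes y′.
relabelling-sending-avoiding : ∀ {n} → 3 ≤ n → {x y : Fin n} → x ≢ y → (x′ y′ : Fin n) →
                               ∃[ π ] Injective _≡_ _≡_ π × π y ≡ y′ × π x ≢ x′
relabelling-sending-avoiding 3≤n {x} {y} x≢y x′ y′ with colour-other-than-both 3≤n x′ y′
... | t , t≢x′ , t≢y′ = transpose a t ∘ transpose y y′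
                      , transpose-injective y y′ ∘ transpose-injective a t
                      , trans (cong (transpose a t) (transpose-sends y y′))
                              (transpose-fixes (a≢y′ ∘ sym) (t≢y′ ∘ sym))
                      , λ πx≡x′ → t≢x′ (trans (sym (transpose-sends a t)) πx≡x′)
  where
  a = transpose y y′ x

  a≢y′ : a ≢ y′
  a≢y′ a≡y′ = x≢y (transpose-injective y y′ (trans a≡y′ (sym (transpose-sends y y′))))

does-true : ∀ {A : Set} (d : Dec A) → does d ≡ true → A
does-true (yes a) _ = a

module _ (X : Graph) where

  vertices-except : DecidableEquality (V X) → V X → VSub X
  vertices-except _≟_ x z = does (¬? (z ≟ x))

  edges-avoiding : DecidableEquality (V X) → V X → ESub X
  edges-avoiding _≟_ x e = does (¬? (proj₁ (ends X e) ≟ x) ×-dec ¬? (proj₂ (ends X e) ≟ x))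

  edges-except : DecidableEquality (E X) → E X → E X → ESub X
  edges-except _≟_ a a′ e = does (¬? (e ≟ a) ×-dec ¬? (e ≟ a′))

  module _ (_≟_ : DecidableEquality (V X)) (x : V X) where

    vertex-deletion-subgraph : IsSubgraph X (vertices-except _≟_ x) (edges-avoiding _≟_ x)
    vertex-deletion-subgraph e avoids
      with does-true (¬? (proj₁ (ends X e) ≟ x) ×-dec ¬? (proj₂ (ends X e) ≟ x)) avoids
    ... | p≢x , q≢x = dec-true (¬? (_ ≟ x)) p≢x , dec-true (¬? (_ ≟ x)) q≢x

    vertex-deletion-proper : IsProper X (vertices-except _≟_ x) (edges-avoiding _≟_ x)
    vertex-deletion-proper = inj₁ (x , dec-false (¬? (x ≟ x)) (λ x≢x → x≢x refl))

    vertices-except-true : ∀ {z} → z ≢ x → vertices-except _≟_ x z ≡ true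
    vertices-except-true z≢x = dec-true (¬? (_ ≟ x)) z≢x

    vertices-except-true⁻¹ : ∀ {z} → vertices-except _≟_ x z ≡ true → z ≢ x
    vertices-except-true⁻¹ = does-true (¬? (_ ≟ x))

    edges-avoiding-true : ∀ {e p q} → Joins X e p q → p ≢ x → q ≢ x → edges-avoiding _≟_ x e ≡ true
    edges-avoiding-true (inj₁ refl) p≢x q≢x = dec-true (¬? (_ ≟ x) ×-dec ¬? (_ ≟ x)) (p≢x , q≢x)
    edges-avoiding-true (inj₂ refl) p≢x q≢x = dec-true (¬? (_ ≟ x) ×-dec ¬? (_ ≟ x)) (q≢x , p≢x)

  module _ (_≟_ : DecidableEquality (E X)) (a a′ : E X) where

    edge-deletion-subgraph : IsSubgraph X (allV X) (edges-except _≟_ a a′)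
    edge-deletion-subgraph _ _ = refl , refl

    edge-deletion-proper : IsProper X (allV X) (edges-except _≟_ a a′)
    edge-deletion-proper = inj₂ (a , dec-false (¬? (a ≟ a) ×-dec ¬? (a ≟ a′)) (λ (a≢a , _) → a≢a refl))

    edges-except-true : ∀ {e} → e ≢ a → e ≢ a′ → edges-except _≟_ a a′ e ≡ true
    edges-except-true e≢a e≢a′ = dec-true (¬? (_ ≟ a) ×-dec ¬? (_ ≟ a′)) (e≢a , e≢a′)

    edges-except-true⁻¹ : ∀ {e} → edges-except _≟_ a a′ e ≡ true → e ≢ a × e ≢ a′
    edges-except-true⁻¹ = does-true (¬? (_ ≟ a) ×-dec ¬? (_ ≟ a′))

critical-colouring : ∀ {X K} → Cri₂ X (suc (suc K)) → ∀ S F → IsSubgraph X S F → IsProper X S F →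
                     Σ[ f ∈ (V X → Fin (suc K)) ] IsForestColouring X S F f
critical-colouring (_ , critical) S F sub proper with critical S F sub proper
... | j , (col , _) , j<k = totalColouring≤ col (≤-pred j<k)

-- Otherwise the two edges could be put back, colouring X with fewer than χ₂(X) colours.
parallel-ends-agree : ∀ {X k j x y a a′} → IsChi₂ X k → j < k → (_≟_ : DecidableEquality (E X)) →
                      Joins X a x y → Joins X a′ x y → {f : V X → Fin j} →
                      IsForestColouring X (allV X) (edges-except X _≟_ a a′) f → f x ≡ f y
parallel-ends-agree {X} {x = x} {y} {a} {a′} (_ , minimal) j<k _≟_ a-joins a′-joins {f} tf
  with f x Finₚ.≟ f y
... | yes fx≡fy = fx≡fy
... | no fx≢fy = contradiction (minimal _ (colourable all-edges)) (<⇒≱ j<k)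
  where
  all-edges : IsForestColouring X (allV X) (allE X) f
  all-edges = add-parallel-edges a-joins a′-joins _≟_ tf (λ _ _ → edges-except-true X _≟_ a a′) fx≢fy

-- χ₂ of a subgraph of a finite graph exists

least-satisfying : {P : ℕ → Set} → Decidable P → ∀ {N} → P N →
                   Σ[ j ∈ ℕ ] j ≤ N × P j × (∀ {i} → i < j → ¬ P i)
least-satisfying {P} P? {N} pN = search N (N , ≤-refl , pN)
  where
  search : ∀ N → ∃[ i ] i ≤ N × P i → Σ[ j ∈ ℕ ] j ≤ N × P j × (∀ {i} → i < j → ¬ P i)
  search zero (zero , _ , p0) = zero , z≤n , p0 , λ ()
  search (suc N) (i , i≤1+N , pi) with anyUpTo? P? (suc N)
  ... | yes (i′ , i′<1+N , pi′) with search N (i′ , ≤-pred i′<1+N , pi′)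
  ...   | j , j≤N , pj , below = j , m≤n⇒m≤1+n j≤N , pj , below
  search (suc N) (i , i≤1+N , pi) | no none with m≤n⇒m<n∨m≡n i≤1+N
  ...   | inj₁ i<1+N = contradiction (i , i<1+N , pi) none
  ...   | inj₂ refl  = suc N , ≤-refl , pi , λ i<1+N pi → none (_ , i<1+N , pi)

any-function? : ∀ {a b} {P : (Fin a → Fin b) → Set} → (∀ {f g} → (∀ i → f i ≡ g i) → P f → P g) →
                (∀ f → Dec (P f)) → Dec (∃ P)
any-function? {zero} resp P? = map′ (_ ,_) (λ (f , p) → resp (λ ()) p) (P? (λ ()))
any-function? {suc a} {P = P} resp P? =
  map′ (λ (c , g , p) → c ∷ g , p) (λ (f , p) → head f , tail f , resp head∷tail p)
       (Finₚ.any? λ c → any-function? (λ f≗g → resp (cons-cong f≗g)) (P? ∘ (c ∷_)))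
  where
  head∷tail : ∀ {f : Fin (suc a) → _} i → f i ≡ (head f ∷ tail f) i
  head∷tail fzero    = refl
  head∷tail (fsuc _) = refl

  cons-cong : ∀ {c} {f g : Fin a → _} → (∀ i → f i ≡ g i) → ∀ i → (c ∷ f) i ≡ (c ∷ g) i
  cons-cong f≗g fzero    = refl
  cons-cong f≗g (fsuc i) = f≗g i

Enumerable : Set → Set
Enumerable A = Σ[ n ∈ ℕ ] Fin n ↩ A

enumerable-finite : ∀ {A n} → A ↔ Fin n → Enumerable A
enumerable-finite {n = n} A↔Fin = n , ↔⇒↩ (↔-sym A↔Fin)

enumerable-⊎ : ∀ {A B} → Enumerable A → Enumerable B → Enumerable (A ⊎ B)
enumerable-⊎ (n , e) (n′ , e′) = n + n′ , (e ⊎-↩ e′) ↩-∘ ↔⇒↩ Finₚ.+↔⊎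

enumerable-Bool : Enumerable Bool
enumerable-Bool = 2 , ↔⇒↩ Finₚ.2↔Bool

enumerable-retract : ∀ {A B} → Enumerable A → A ↩ B → Enumerable B
enumerable-retract (n , e) r = n , r ↩-∘ e

module Enumeration {A : Set} (enumeration : Enumerable A) where
  open LeftInverse (proj₂ enumeration) public using (to; from) renaming (strictlyInverseˡ to to-from)

  from-injective : ∀ {x y} → from x ≡ from y → x ≡ y
  from-injective {x} {y} eq = trans (sym (to-from x)) (trans (cong to eq) (to-from y))

  _≟_ : DecidableEquality A
  x ≟ y = map′ from-injective (cong from) (from x Finₚ.≟ from y)

module Decision (X : Graph) (enumV : Enumerable (V X)) (enumE : Enumerable (E X))
                (S : VSub X) (F : ESub X) where

  private
    module EV = Enumeration enumV
    module EE = Enumeration enumE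
    n = proj₁ enumV
    m = proj₁ enumE

  -- A monochromatic cycle of (S , F), unpacked into a product so that it can be decided.
  MonoCycleOn : ∀ {j} → (V X → Fin j) → (l : ℕ) → (Fin (suc l) → V X) → (Fin (suc l) → E X) → Set
  MonoCycleOn h l vs es =
      1 ≤ l
    × (∀ i k → vs i ≡ vs k → i ≡ k)
    × (∀ i k → es i ≡ es k → i ≡ k)
    × (∀ (i : Fin l) → Joins X (es (inject₁ i)) (vs (inject₁ i)) (vs (fsuc i)))
    × Joins X (es (fromℕ l)) (vs (fromℕ l)) (vs fzero)
    × (∀ i → S (vs i) ≡ true)
    × (∀ i → F (es i) ≡ true)
    × (∀ i → h (vs i) ≡ h (vs fzero))

  private
    joins? : ∀ e x y → Dec (Joins X e x y)
    joins? e x y = ≡-dec EV._≟_ EV._≟_ (ends X e) (x , y) ⊎-dec ≡-dec EV._≟_ EV._≟_ (ends X e) (y , x)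

    MonoCycleOn? : ∀ {j} (h : V X → Fin j) l vs es → Dec (MonoCycleOn h l vs es)
    MonoCycleOn? h l vs es =
          1 ≤? l
      ×-dec Finₚ.all? (λ i → Finₚ.all? λ k → (vs i EV.≟ vs k) →-dec (i Finₚ.≟ k))
      ×-dec Finₚ.all? (λ i → Finₚ.all? λ k → (es i EE.≟ es k) →-dec (i Finₚ.≟ k))
      ×-dec Finₚ.all? (λ i → joins? _ _ _)
      ×-dec joins? _ _ _
      ×-dec Finₚ.all? (λ i → S (vs i) Boolₚ.≟ true)
      ×-dec Finₚ.all? (λ i → F (es i) Boolₚ.≟ true)
      ×-dec Finₚ.all? (λ i → h (vs i) Finₚ.≟ h (vs fzero))

    MonoCycleOn-cong : ∀ {j} {h : V X → Fin j} {l vs es vs′ es′} →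
                       (∀ i → vs i ≡ vs′ i) → (∀ i → es i ≡ es′ i) →
                       MonoCycleOn h l vs es → MonoCycleOn h l vs′ es′
    MonoCycleOn-cong {h = h} {vs′ = vs′} vs≗ es≗ (1≤l , vs-inj , es-inj , steps , closing , inS , inF , mono) =
        1≤l
      , (λ i k eq → vs-inj i k (trans (vs≗ i) (trans eq (sym (vs≗ k)))))
      , (λ i k eq → es-inj i k (trans (es≗ i) (trans eq (sym (es≗ k)))))
      , (λ i → subst₂ (λ e x → Joins X e x (vs′ (fsuc i))) (es≗ _) (vs≗ _)
                      (subst (Joins X _ _) (vs≗ _) (steps i)))
      , subst₂ (λ e x → Joins X e x (vs′ fzero)) (es≗ _) (vs≗ _) (subst (Joins X _ _) (vs≗ _) closing)
      , (λ i → trans (cong S (sym (vs≗ i))) (inS i))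
      , (λ i → trans (cong F (sym (es≗ i))) (inF i))
      , (λ i → trans (cong h (sym (vs≗ i))) (trans (mono i) (cong h (vs≗ fzero))))

    EnumeratedMonoCycle : ∀ {j} → (V X → Fin j) → ℕ → Set
    EnumeratedMonoCycle h l = Σ[ g ∈ (Fin (suc l) → Fin n) ] Σ[ g′ ∈ (Fin (suc l) → Fin m) ]
                                MonoCycleOn h l (EV.to ∘ g) (EE.to ∘ g′)

    EnumeratedMonoCycle? : ∀ {j} (h : V X → Fin j) l → Dec (EnumeratedMonoCycle h l)
    EnumeratedMonoCycle? h l =
      any-function? (λ g≗ (g′ , mc) → g′ , MonoCycleOn-cong {h = h} (cong EV.to ∘ g≗) (λ _ → refl) mc)
        (λ g → any-function? (λ g′≗ → MonoCycleOn-cong {h = h} (λ _ → refl) (cong EE.to ∘ g′≗))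
          (λ g′ → MonoCycleOn? h l _ _))

    enumerate : ∀ {j} {h : V X → Fin j} → MonoCircuit X S F h → ∃[ l ] l < n × EnumeratedMonoCycle h l
    enumerate {h = h} M = enumerate-cycle (Circuit⇒Cycle (circuit M))
                            (vertices-in M ∘ toℕ≤) (edges-in M ∘ toℕ≤) (monochromatic M ∘ toℕ≤)
      where
      -- By the pigeonhole principle a cycle has fewer than n vertices.
      enumerate-cycle : (C : Cycle X) → (∀ i → S (vs C i) ≡ true) → (∀ i → F (es C i) ≡ true) →
                        (∀ i → h (vs C i) ≡ h (vs C fzero)) → ∃[ l ] l < n × EnumeratedMonoCycle h l
      enumerate-cycle C inS inF mono with l C <? n
      ... | yes l<n = l C , l<n , EV.from ∘ vs C , EE.from ∘ es C ,
            MonoCycleOn-cong {h = h} (sym ∘ EV.to-from ∘ vs C) (sym ∘ EE.to-from ∘ es C)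
              (l≥1 C , (λ _ _ → vs-inj C) , (λ _ _ → es-inj C) , step C , close C , inS , inF , mono)
      ... | no l≮n with i , k , i<k , eq ← Finₚ.pigeonhole (s≤s (≮⇒≥ l≮n)) (EV.from ∘ vs C) =
            contradiction (vs-inj C (EV.from-injective eq)) (Finₚ.<⇒≢ i<k)

    mono-circuit : ∀ {j} {h : V X → Fin j} {l} → EnumeratedMonoCycle h l → MonoCircuit X S F h
    mono-circuit {h = h} (g , g′ , 1≤l , vs-inj , es-inj , steps , closing , inS , inF , mono) = record
      { circuit       = Cycle⇒Circuit C
      ; vertices-in   = λ _ → inS _
      ; edges-in      = λ _ → inF _
      ; monochromatic = λ _ → trans (mono _) (cong (h ∘ EV.to ∘ g) (sym (clamp-at fzero refl)))
      }
      where
      C : Cycle X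
      C = record { l = _ ; l≥1 = 1≤l ; vs = EV.to ∘ g ; es = EE.to ∘ g′
                 ; vs-inj = vs-inj _ _ ; es-inj = es-inj _ _ ; step = steps ; close = closing }

  isForestColouring? : ∀ {j} (h : V X → Fin j) → Dec (IsForestColouring X S F h)
  isForestColouring? h =
    map′ (λ none M → none (enumerate M)) (λ tf (_ , _ , mc) → tf (mono-circuit mc))
         (¬? (anyUpTo? (EnumeratedMonoCycle? h) n))

  colourable? : ∀ j → Dec (Colourable X S F j)
  colourable? zero =
    map′ uncoloured (λ (c , _) i → uncolourable c i) (Finₚ.all? λ i → S (EV.to i) Boolₚ.≟ false)
    where
    outside : (∀ i → S (EV.to i) ≡ false) → ∀ v → S v ≢ true
    outside none v Sv = contradiction (trans (sym Sv) (trans (sym (cong S (EV.to-from v))) (none (EV.from v)))) λ ()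

    uncoloured : (∀ i → S (EV.to i) ≡ false) → Colourable X S F zero
    uncoloured none = (λ v Sv → ⊥-elim (outside none v Sv)) , λ C (inS , _) _ → outside none _ (inS fzero)

    uncolourable : Colouring X S zero → ∀ i → S (EV.to i) ≡ false
    uncolourable c i with S (EV.to i) in Sv
    ... | false = refl
    ... | true  with () ← c (EV.to i) Sv
  colourable? (suc j) =
    map′ (λ (_ , tf) → colourable tf)
         (λ col → let f , tf = totalColouring≤ col ≤-refl in
                  f ∘ EV.to , recolour tf (λ v _ → cong f (EV.to-from v)))
         (any-function? (λ g≗g′ tf → recolour tf (λ v _ → sym (g≗g′ (EV.from v))))
                        (λ g → isForestColouring? (g ∘ EV.from)))

  χ₂-exists : ∀ {N} → Colourable X S F N → Σ[ j ∈ ℕ ] j ≤ N × IsChi₂Sub X S F j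
  χ₂-exists col with least-satisfying colourable? col
  ... | j , j≤N , colj , below = j , j≤N , colj , λ i coli → ≮⇒≥ (λ i<j → below i<j coli)

crossing : {P : ℕ → Set} → Decidable P → ∀ {a b} → a ≤ b → P a → ¬ P b →
           ∃[ q ] a ≤ q × q < b × P q × ¬ P (suc q)
crossing P? {b = zero} z≤n pa ¬pb = contradiction pa ¬pb
crossing P? {b = suc b} a≤1+b pa ¬pb with m≤n⇒m<n∨m≡n a≤1+b
... | inj₂ refl  = contradiction pa ¬pb
... | inj₁ a<1+b with P? b
...   | yes pb = b , ≤-pred a<1+b , ≤-refl , pb , ¬pb
...   | no ¬pb′ with crossing P? (≤-pred a<1+b) pa ¬pb′
...     | q , a≤q , q<b , pq , ¬pq′ = q , a≤q , m<n⇒m<1+n q<b , pq , ¬pq′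

constant-between : (g : ℕ → Bool) (W : ℕ → Set) {a b : ℕ} →
                   (∀ {k} → a ≤ k → k < b → g k ≢ g (suc k) → W (suc k)) →
                   (∀ {k} → a < k → k ≤ b → ¬ W k) →
                   ∀ {k} → a ≤ k → k ≤ b → g k ≡ g a
constant-between g W {a} change none {k} a≤k k≤b with g k Boolₚ.≟ g a
... | yes gk≡ga = gk≡ga
... | no gk≢ga with crossing (λ i → g i Boolₚ.≟ g a) a≤k refl gk≢ga
...   | q , a≤q , q<k , gq≡ga , gq′≢ga =
  ⊥-elim (none (s≤s a≤q) (≤-trans q<k k≤b)
                (change a≤q (<-≤-trans q<k k≤b) λ gq≡gq′ → gq′≢ga (trans (sym gq≡gq′) gq≡ga)))

-- The Hajós 2-join

module Hajós (G₁ G₂ : Graph)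
             (_≟V₂_ : DecidableEquality (V G₂))
             (_≟E₁_ : DecidableEquality (E G₁))
             (_≟E₂_ : DecidableEquality (E G₂))
             (u₁ v₁ : V G₁) (u₁≢v₁ : u₁ ≢ v₁) (e₁ e₁′ : E G₁) (e₁≢e₁′ : e₁ ≢ e₁′)
             (e₁-joins : Joins G₁ e₁ u₁ v₁) (e₁′-joins : Joins G₁ e₁′ u₁ v₁)
             (u₂ v₂ : V G₂) (u₂≢v₂ : u₂ ≢ v₂) (e₂ e₂′ : E G₂) (e₂≢e₂′ : e₂ ≢ e₂′)
             (e₂-joins : Joins G₂ e₂ u₂ v₂) (e₂′-joins : Joins G₂ e₂′ u₂ v₂) where

  open HajosJoin G₁ G₂ _≟V₂_ _≟E₁_ _≟E₂_ u₁ v₁ e₁ e₁′ u₂ v₂ e₂ e₂′ public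

  G : Graph
  G = join

  back₁ : JV → V G₁
  back₁ (inj₁ x) = x
  back₁ (inj₂ _) = v₁

  back₂ : JV → V G₂
  back₂ (inj₁ _)       = v₂
  back₂ (inj₂ (y , _)) = y

  back₂-ι₂ : ∀ y → back₂ (ι₂ y) ≡ y
  back₂-ι₂ y with y ≟V₂ v₂
  ... | yes y≡v₂ = sym y≡v₂
  ... | no _     = refl

  ι₂-injective : ∀ {y y′} → ι₂ y ≡ ι₂ y′ → y ≡ y′
  ι₂-injective {y} {y′} eq = trans (sym (back₂-ι₂ y)) (trans (cong back₂ eq) (back₂-ι₂ y′))

  ι₂-v₂ : ι₂ v₂ ≡ inj₁ v₁
  ι₂-v₂ with v₂ ≟V₂ v₂
  ... | yes _    = refl
  ... | no v₂≢v₂ = contradiction refl v₂≢v₂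

  ι₂-distinct : ∀ {y} (p : False (y ≟V₂ v₂)) → ι₂ y ≡ inj₂ (y , p)
  ι₂-distinct {y} p = from-no (y ≟V₂ v₂) (toWitnessFalse p)
    where
    from-no : (d : Dec (y ≡ v₂)) → ¬ y ≡ v₂ → ι₂' y d ≡ inj₂ (y , p)
    from-no (yes y≡v₂) y≢v₂ = contradiction y≡v₂ y≢v₂
    from-no (no _)     _    = cong (λ p → inj₂ (y , p)) (Boolₚ.T-irrelevant _ _)

  ι₂≡inj₁ : ∀ {y x} → ι₂ y ≡ inj₁ x → x ≡ v₁
  ι₂≡inj₁ {y} eq with y ≟V₂ v₂
  ι₂≡inj₁ refl | yes _ = refl
  ι₂≡inj₁ ()   | no _

  ι₂-u₂ : ∀ {x} → ι₂ u₂ ≢ inj₁ x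
  ι₂-u₂ eq with refl ← ι₂≡inj₁ eq = u₂≢v₂ (ι₂-injective (trans eq (sym ι₂-v₂)))

  In₁ In₂ : JV → Set
  In₁ w = ∃[ x ] w ≡ inj₁ x
  In₂ w = ∃[ y ] w ≡ ι₂ y

  In₁∧In₂ : ∀ {w} → In₁ w → In₂ w → w ≡ inj₁ v₁
  In₁∧In₂ (x , refl) (y , eq) = cong inj₁ (ι₂≡inj₁ (sym eq))

  In₁-back : ∀ {w} → In₁ w → inj₁ (back₁ w) ≡ w
  In₁-back (_ , refl) = refl

  In₂-back : ∀ {w} → In₂ w → ι₂ (back₂ w) ≡ w
  In₂-back (y , refl) = cong ι₂ (back₂-ι₂ y)

  back₁-injective : ∀ {w w′} → In₁ w → In₁ w′ → back₁ w ≡ back₁ w′ → w ≡ w′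
  back₁-injective in₁ in₁′ eq = trans (sym (In₁-back in₁)) (trans (cong inj₁ eq) (In₁-back in₁′))

  back₂-injective : ∀ {w w′} → In₂ w → In₂ w′ → back₂ w ≡ back₂ w′ → w ≡ w′
  back₂-injective in₂ in₂′ eq = trans (sym (In₂-back in₂)) (trans (cong ι₂ eq) (In₂-back in₂′))

  isG₁ isG₂ isNew : JE → Bool
  isG₁ (inj₁ _) = true
  isG₁ (inj₂ _) = false
  isG₂ (inj₂ (inj₁ _)) = true
  isG₂ _               = false
  isNew (inj₂ (inj₂ _)) = true
  isNew _               = false

  old-G₂ : ∀ e → isNew e ≡ false → isG₁ e ≡ false → isG₂ e ≡ true
  old-G₂ (inj₂ (inj₁ _)) _ _ = refl

  new-edge : ∀ {e} → isNew e ≡ true → ∃[ b ] e ≡ inj₂ (inj₂ b)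
  new-edge {inj₂ (inj₂ b)} _ = b , refl

  -- Junk values on edges of the wrong kind.
  back₁ᴱ : JE → E G₁
  back₁ᴱ (inj₁ (e , _)) = e
  back₁ᴱ _              = e₁

  back₂ᴱ : JE → E G₂
  back₂ᴱ (inj₂ (inj₁ (e , _))) = e
  back₂ᴱ _                     = e₂

  back₁ᴱ-injective : ∀ {e e′} → isG₁ e ≡ true → isG₁ e′ ≡ true → back₁ᴱ e ≡ back₁ᴱ e′ → e ≡ e′
  back₁ᴱ-injective {inj₁ (e , p , q)} {inj₁ (.e , p′ , q′)} _ _ refl
    rewrite Boolₚ.T-irrelevant p p′ | Boolₚ.T-irrelevant q q′ = refl

  back₂ᴱ-injective : ∀ {e e′} → isG₂ e ≡ true → isG₂ e′ ≡ true → back₂ᴱ e ≡ back₂ᴱ e′ → e ≡ e′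
  back₂ᴱ-injective {inj₂ (inj₁ (e , p , q))} {inj₂ (inj₁ (.e , p′ , q′))} _ _ refl
    rewrite Boolₚ.T-irrelevant p p′ | Boolₚ.T-irrelevant q q′ = refl

  back₁ᴱ-≢ : ∀ {e} → isG₁ e ≡ true → back₁ᴱ e ≢ e₁ × back₁ᴱ e ≢ e₁′
  back₁ᴱ-≢ {inj₁ (_ , p , q)} _ = toWitnessFalse p , toWitnessFalse q

  back₂ᴱ-≢ : ∀ {e} → isG₂ e ≡ true → back₂ᴱ e ≢ e₂ × back₂ᴱ e ≢ e₂′
  back₂ᴱ-≢ {inj₂ (inj₁ (_ , p , q))} _ = toWitnessFalse p , toWitnessFalse q

  G₁-edge-ends : ∀ {e x y} → isG₁ e ≡ true → Joins G e x y →
                 In₁ x × In₁ y × Joins G₁ (back₁ᴱ e) (back₁ x) (back₁ y)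
  G₁-edge-ends {inj₁ _} _ (inj₁ refl) = (_ , refl) , (_ , refl) , inj₁ refl
  G₁-edge-ends {inj₁ _} _ (inj₂ refl) = (_ , refl) , (_ , refl) , inj₂ refl

  G₂-edge-ends : ∀ {e x y} → isG₂ e ≡ true → Joins G e x y →
                 In₂ x × In₂ y × Joins G₂ (back₂ᴱ e) (back₂ x) (back₂ y)
  G₂-edge-ends {inj₂ (inj₁ (e , _))} _ (inj₁ refl)
    rewrite back₂-ι₂ (proj₁ (ends G₂ e)) | back₂-ι₂ (proj₂ (ends G₂ e))
    = (_ , refl) , (_ , refl) , inj₁ refl
  G₂-edge-ends {inj₂ (inj₁ (e , _))} _ (inj₂ refl)
    rewrite back₂-ι₂ (proj₁ (ends G₂ e)) | back₂-ι₂ (proj₂ (ends G₂ e))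
    = (_ , refl) , (_ , refl) , inj₂ refl

  new-edge-ends : ∀ {e x y} → isNew e ≡ true → Joins G e x y →
                  (x ≡ inj₁ u₁ × y ≡ ι₂ u₂) ⊎ (x ≡ ι₂ u₂ × y ≡ inj₁ u₁)
  new-edge-ends {inj₂ (inj₂ _)} _ (inj₁ refl) = inj₁ (refl , refl)
  new-edge-ends {inj₂ (inj₂ _)} _ (inj₂ refl) = inj₂ (refl , refl)

  old-edge-ends : ∀ {e x y} → isNew e ≡ false → Joins G e x y →
                  (isG₁ e ≡ true × In₁ x × In₁ y) ⊎ (isG₁ e ≡ false × In₂ x × In₂ y)
  old-edge-ends {inj₁ e} _ joins =
    let in₁ , in₁′ , _ = G₁-edge-ends {inj₁ e} refl joins in inj₁ (refl , in₁ , in₁′)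
  old-edge-ends {inj₂ (inj₁ e)} _ joins =
    let in₂ , in₂′ , _ = G₂-edge-ends {inj₂ (inj₁ e)} refl joins in inj₂ (refl , in₂ , in₂′)

  side-change-at-v₁ : ∀ {a b x w y} → isNew a ≡ false → isNew b ≡ false → isG₁ a ≢ isG₁ b →
                      Joins G a x w → Joins G b w y → w ≡ inj₁ v₁
  side-change-at-v₁ a-old b-old sides a-joins b-joins
    with old-edge-ends a-old a-joins | old-edge-ends b-old b-joins
  ... | inj₁ (a₁ , _ , in₁) | inj₁ (b₁ , _ , _)   = contradiction (trans a₁ (sym b₁)) sides
  ... | inj₂ (a₂ , _ , in₂) | inj₂ (b₂ , _ , _)   = contradiction (trans a₂ (sym b₂)) sides
  ... | inj₁ (_ , _ , in₁)  | inj₂ (_ , in₂ , _)  = In₁∧In₂ in₁ in₂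
  ... | inj₂ (_ , _ , in₂)  | inj₁ (_ , in₁ , _)  = In₁∧In₂ in₁ in₂

  old-edge-at-G₁-vertex : ∀ {e w y x} → isNew e ≡ false → Joins G e w y → w ≡ inj₁ x → x ≢ v₁ →
                          isG₁ e ≡ true
  old-edge-at-G₁-vertex old joins refl x≢v₁ with old-edge-ends old joins
  ... | inj₁ (G₁-edge , _)  = G₁-edge
  ... | inj₂ (_ , in₂ , _) = contradiction (inj₁-injective (In₁∧In₂ (_ , refl) in₂)) x≢v₁

  old-edge-at-u₂ : ∀ {e w y} → isNew e ≡ false → Joins G e w y → w ≡ ι₂ u₂ → isG₁ e ≡ false
  old-edge-at-u₂ old joins refl with old-edge-ends old joins
  ... | inj₁ (_ , (_ , eq) , _) = contradiction eq ι₂-u₂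
  ... | inj₂ (G₂-edge , _)      = G₂-edge

  Visits-v₁ : Circuit G → ℕ → Set
  Visits-v₁ C k = vertex C k ≡ inj₁ v₁

  side-change-on : (C : Circuit G) → ∀ {k} → k < len C →
                   isNew (edge C k) ≡ false → isNew (edge C (suc k)) ≡ false →
                   isG₁ (edge C k) ≢ isG₁ (edge C (suc k)) → Visits-v₁ C (suc k)
  side-change-on C k<l old old′ differs = side-change-at-v₁ old old′ differs (step C k<l) (step↻ C k<l)

  visits-v₁-once : (C : Circuit G) → ∀ {i k} → i ≤ len C → k ≤ len C →
                   Visits-v₁ C i → Visits-v₁ C k → i ≡ k
  visits-v₁-once C i≤l k≤l visits visits′ = vertex-injective C i≤l k≤l (trans visits (sym visits′))

  single-switch : (C : Circuit G) {a b : ℕ} → a ≤ b → b ≤ len C →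
                  (∀ {i} → a ≤ i → i ≤ b → isNew (edge C i) ≡ false) →
                  isG₁ (edge C a) ≢ isG₁ (edge C b) →
                  ∃[ q ] q < b × Visits-v₁ C (suc q)
                       × (∀ {i} → a ≤ i → i ≤ q → isG₁ (edge C i) ≡ isG₁ (edge C a))
                       × (∀ {i} → suc q ≤ i → i ≤ b → isG₁ (edge C i) ≡ isG₁ (edge C b))
  single-switch C {a} {b} a≤b b≤l old ends-differ
    with crossing (λ i → side i Boolₚ.≟ side a) a≤b refl (ends-differ ∘ sym)
    where side = isG₁ ∘ edge C
  ... | q , a≤q , q<b , sq≡sa , sq′≢sa = q , q<b , visits , before , after
    where
    side = isG₁ ∘ edge C

    once : ∀ {i k} → i ≤ b → k ≤ b → Visits-v₁ C i → Visits-v₁ C k → i ≡ k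
    once i≤b k≤b = visits-v₁-once C (≤-trans i≤b b≤l) (≤-trans k≤b b≤l)

    change : ∀ {i} → a ≤ i → i < b → side i ≢ side (suc i) → Visits-v₁ C (suc i)
    change a≤i i<b =
      side-change-on C (<-≤-trans i<b b≤l) (old a≤i (<⇒≤ i<b)) (old (≤-trans a≤i (n≤1+n _)) i<b)

    visits : Visits-v₁ C (suc q)
    visits = change a≤q q<b (λ sq≡sq′ → sq′≢sa (trans (sym sq≡sq′) sq≡sa))

    before : ∀ {i} → a ≤ i → i ≤ q → side i ≡ side a
    before = constant-between side (Visits-v₁ C) (λ a≤k k<q → change a≤k (<-trans k<q q<b))
               (λ _ k≤q visits′ → <-irrefl (once (≤-trans k≤q (<⇒≤ q<b)) q<b visits′ visits) (s≤s k≤q))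

    after : ∀ {i} → suc q ≤ i → i ≤ b → side i ≡ side b
    after q′≤i i≤b =
      trans (constant-between side (Visits-v₁ C) (λ q′≤k → change (≤-trans a≤q (≤-trans (n≤1+n q) q′≤k)))
               (λ q′<k k≤b visits′ → <-irrefl (once q<b k≤b visits visits′) q′<k) q′≤i i≤b)
            (trans (Boolₚ.¬-not sq′≢sa) (sym (Boolₚ.¬-not (ends-differ ∘ sym))))

  -- The circuit passes v₁ at most once, but would have to change sides twice.
  one-sided : (C : Circuit G) → (∀ {k} → k ≤ len C → isNew (edge C k) ≡ false) →
              ∀ {k} → k ≤ len C → isG₁ (edge C k) ≡ isG₁ (edge C 0)
  one-sided C old {k} k≤l with side k Boolₚ.≟ side 0
    where side = isG₁ ∘ edge C
  ... | yes same = same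
  ... | no differs with crossing (λ i → isG₁ (edge C i) Boolₚ.≟ isG₁ (edge C 0)) z≤n refl differs
  ...   | q , _ , q<k , sq≡s0 , sq′≢s0 = contradiction (visits-v₁-once C z≤n p≤l returns visits) λ ()
    where
    side = isG₁ ∘ edge C
    p≤l = ≤-trans q<k k≤l

    change : ∀ {i} → i < len C → side i ≢ side (suc i) → Visits-v₁ C (suc i)
    change i<l = side-change-on C i<l (old (<⇒≤ i<l)) (old i<l)

    visits : Visits-v₁ C (suc q)
    visits = change p≤l (λ sq≡sq′ → sq′≢s0 (trans (sym sq≡sq′) sq≡s0))

    stays : side (len C) ≡ side (suc q)
    stays = constant-between side (Visits-v₁ C) (λ _ → change)
              (λ q′<i i≤l visits′ → <-irrefl (visits-v₁-once C p≤l i≤l visits visits′) q′<i)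
              p≤l ≤-refl

    returns : Visits-v₁ C 0
    returns = side-change-at-v₁ (old ≤-refl) (old z≤n) (λ sl≡s0 → sq′≢s0 (trans (sym stays) sl≡s0))
                                (close C) (step↻ C z≤n)

  module _ {j : ℕ} {S : VSub G} {F : ESub G} {f : JV → Fin j} (M : MonoCircuit G S F f) where

    private
      C = circuit M

    project₁ : ∀ {S₁ F₁} → (∀ x → S (inj₁ x) ≡ true → S₁ x ≡ true) →
               (∀ e → isG₁ e ≡ true → F e ≡ true → F₁ (back₁ᴱ e) ≡ true) →
               (∀ {k} → k ≤ len C → isG₁ (edge C k) ≡ true) → MonoCircuit G₁ S₁ F₁ (f ∘ inj₁)
    project₁ S⊆ F⊆ G₁-edges = record
      { circuit       = map-circuit C back₁ back₁ᴱ
                          (λ i≤l j≤l → back₁-injective (in₁ i≤l) (in₁ j≤l))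
                          (λ i≤l j≤l → back₁ᴱ-injective (G₁-edges i≤l) (G₁-edges j≤l))
                          (λ k≤l → proj₂ ∘ proj₂ ∘ G₁-edge-ends (G₁-edges k≤l))
      ; vertices-in   = λ k≤l → S⊆ _ (subst (λ w → S w ≡ true) (sym (In₁-back (in₁ k≤l))) (vertices-in M k≤l))
      ; edges-in      = λ k≤l → F⊆ _ (G₁-edges k≤l) (edges-in M k≤l)
      ; monochromatic = λ k≤l → trans (cong f (In₁-back (in₁ k≤l)))
                                      (trans (monochromatic M k≤l) (sym (cong f (In₁-back (in₁ z≤n)))))
      }
      where
      in₁ : ∀ {k} → k ≤ len C → In₁ (vertex C k)
      in₁ k≤l = proj₁ (G₁-edge-ends (G₁-edges k≤l) (step↻ C k≤l))

    project₂ : ∀ {S₂ F₂} → (∀ y → S (ι₂ y) ≡ true → S₂ y ≡ true) →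
               (∀ e → isG₂ e ≡ true → F e ≡ true → F₂ (back₂ᴱ e) ≡ true) →
               (∀ {k} → k ≤ len C → isG₂ (edge C k) ≡ true) → MonoCircuit G₂ S₂ F₂ (f ∘ ι₂)
    project₂ S⊆ F⊆ G₂-edges = record
      { circuit       = map-circuit C back₂ back₂ᴱ
                          (λ i≤l j≤l → back₂-injective (in₂ i≤l) (in₂ j≤l))
                          (λ i≤l j≤l → back₂ᴱ-injective (G₂-edges i≤l) (G₂-edges j≤l))
                          (λ k≤l → proj₂ ∘ proj₂ ∘ G₂-edge-ends (G₂-edges k≤l))
      ; vertices-in   = λ k≤l → S⊆ _ (subst (λ w → S w ≡ true) (sym (In₂-back (in₂ k≤l))) (vertices-in M k≤l))
      ; edges-in      = λ k≤l → F⊆ _ (G₂-edges k≤l) (edges-in M k≤l)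
      ; monochromatic = λ k≤l → trans (cong f (In₂-back (in₂ k≤l)))
                                      (trans (monochromatic M k≤l) (sym (cong f (In₂-back (in₂ z≤n)))))
      }
      where
      in₂ : ∀ {k} → k ≤ len C → In₂ (vertex C k)
      in₂ k≤l = proj₁ (G₂-edge-ends (G₂-edges k≤l) (step↻ C k≤l))

  -- Gluing colourings

  NewEdgesHarmless : (S : VSub G) (F : ESub G) {j : ℕ} → (JV → Fin j) → Set
  NewEdgesHarmless S F f =
    (M : MonoCircuit G S F f) → ∀ {k} → k ≤ len (circuit M) → isNew (edge (circuit M) k) ≢ true

  glue : ∀ {j S F} {f : JV → Fin j} {S₁ F₁ S₂ F₂} →
         IsForestColouring G₁ S₁ F₁ (f ∘ inj₁) → IsForestColouring G₂ S₂ F₂ (f ∘ ι₂) →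
         (∀ x → S (inj₁ x) ≡ true → S₁ x ≡ true) →
         (∀ e → isG₁ e ≡ true → F e ≡ true → F₁ (back₁ᴱ e) ≡ true) →
         (∀ y → S (ι₂ y) ≡ true → S₂ y ≡ true) →
         (∀ e → isG₂ e ≡ true → F e ≡ true → F₂ (back₂ᴱ e) ≡ true) →
         NewEdgesHarmless S F f → IsForestColouring G S F f
  glue tf₁ tf₂ S⊆₁ F⊆₁ S⊆₂ F⊆₂ harmless M
    with anyUpTo? (λ k → isNew (edge (circuit M) k) Boolₚ.≟ true) (suc (len (circuit M)))
  ... | yes (k , k<1+l , new) = harmless M (≤-pred k<1+l) new
  ... | no none = by-side (isG₁ (edge C 0)) refl
    where
    C = circuit M

    old : ∀ {k} → k ≤ len C → isNew (edge C k) ≡ false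
    old k≤l = Boolₚ.¬-not λ new → none (_ , s≤s k≤l , new)

    by-side : ∀ b → isG₁ (edge C 0) ≡ b → ⊥
    by-side true  side₀ = tf₁ (project₁ M S⊆₁ F⊆₁ λ k≤l → trans (one-sided C old k≤l) side₀)
    by-side false side₀ =
      tf₂ (project₂ M S⊆₂ F⊆₂ λ k≤l → old-G₂ _ (old k≤l) (trans (one-sided C old k≤l) side₀))

  harmless-if-u-colours-differ : ∀ {j S F} {f : JV → Fin j} →
                                 (∀ b → F (inj₂ (inj₂ b)) ≡ true → f (inj₁ u₁) ≢ f (ι₂ u₂)) →
                                 NewEdgesHarmless S F f
  harmless-if-u-colours-differ {F = F} {f} differ M {k} k≤l new with new-edge new
  ... | b , eq = differ b (subst (λ e → F e ≡ true) eq (edges-in M k≤l))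
                          (same-colour (new-edge-ends new (step↻ C k≤l)))
    where
    C = circuit M

    colour : ∀ {i w} → i ≤ len C → vertex C i ≡ w → f w ≡ f (vertex C 0)
    colour i≤l refl = monochromatic M i≤l

    same-colour : _ → f (inj₁ u₁) ≡ f (ι₂ u₂)
    same-colour (inj₁ (at-u₁ , at-u₂)) = trans (colour k≤l at-u₁) (sym (colour (next-≤ k≤l) at-u₂))
    same-colour (inj₂ (at-u₂ , at-u₁)) = trans (colour (next-≤ k≤l) at-u₁) (sym (colour k≤l at-u₂))

  joint : ∀ {j} → (V G₁ → Fin j) → (V G₂ → Fin j) → JV → Fin j
  joint f₁ f₂ (inj₁ x)       = f₁ x
  joint f₁ f₂ (inj₂ (y , _)) = f₂ y

  joint-ι₂ : ∀ {j} {f₁ : V G₁ → Fin j} {f₂ : V G₂ → Fin j} → f₂ v₂ ≡ f₁ v₁ →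
             ∀ y → joint f₁ f₂ (ι₂ y) ≡ f₂ y
  joint-ι₂ agree y with y ≟V₂ v₂
  ... | yes refl = sym agree
  ... | no _     = refl

  joint-ι₂-≢ : ∀ {j} {f₁ : V G₁ → Fin j} {f₂ : V G₂ → Fin j} {y} → y ≢ v₂ →
               joint f₁ f₂ (ι₂ y) ≡ f₂ y
  joint-ι₂-≢ {y = y} y≢v₂ with y ≟V₂ v₂
  ... | yes y≡v₂ = contradiction y≡v₂ y≢v₂
  ... | no _     = refl

  glue-aligned : ∀ {j S F S₁ F₁ S₂ F₂} {f₁ : V G₁ → Fin j} {f₂ : V G₂ → Fin j} →
                 IsForestColouring G₁ S₁ F₁ f₁ → IsForestColouring G₂ S₂ F₂ f₂ → f₂ v₂ ≡ f₁ v₁ →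
                 (∀ x → S (inj₁ x) ≡ true → S₁ x ≡ true) →
                 (∀ e → isG₁ e ≡ true → F e ≡ true → F₁ (back₁ᴱ e) ≡ true) →
                 (∀ y → S (ι₂ y) ≡ true → S₂ y ≡ true) →
                 (∀ e → isG₂ e ≡ true → F e ≡ true → F₂ (back₂ᴱ e) ≡ true) →
                 NewEdgesHarmless S F (joint f₁ f₂) → Colourable G S F j
  glue-aligned {f₁ = f₁} {f₂} tf₁ tf₂ aligned S⊆₁ F⊆₁ S⊆₂ F⊆₂ harmless =
    colourable (glue {f = joint f₁ f₂} tf₁ (recolour tf₂ λ y _ → joint-ι₂ aligned y) S⊆₁ F⊆₁ S⊆₂ F⊆₂ harmless)

  module _ {j : ℕ} {S : VSub G} {F : ESub G} {b₀ : Bool} {f : JV → Fin j}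
           (b₀-deleted : F (inj₂ (inj₂ b₀)) ≡ false)
           (tf₁ : IsForestColouring G₁ (allV G₁) (edges-except G₁ _≟E₁_ e₁ e₁) (f ∘ inj₁)) where

    -- A stretch of G₁-edges of a monochromatic circuit between u₁ and v₁ closes up with e₁′
    -- to a monochromatic cycle of G₁ − e₁.
    module Stretch (M : MonoCircuit G S F f) {s m : ℕ} {a b : V G₁}
                   (1≤m : 1 ≤ m) (s+m≤l : s + m ≤ len (circuit M))
                   (G₁-edges : ∀ {i} → i < m → isG₁ (edge (circuit M) (s + i)) ≡ true)
                   (start : vertex (circuit M) s ≡ inj₁ a) (end : vertex (circuit M) (s + m) ≡ inj₁ b)
                   (closing : Joins G₁ e₁′ b a) where

      private
        C = circuit M

        bound : ∀ {i} → i ≤ m → s + i ≤ len C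
        bound i≤m = ≤-trans (+-monoʳ-≤ s i≤m) s+m≤l

        in₁ : ∀ {i} → i ≤ m → In₁ (vertex C (s + i))
        in₁ {i} i≤m with m≤n⇒m<n∨m≡n i≤m
        ... | inj₁ i<m  = proj₁ (G₁-edge-ends (G₁-edges i<m) (step↻ C (bound i≤m)))
        ... | inj₂ refl = _ , end

        colour : ∀ {i} → i ≤ m → f (inj₁ (back₁ (vertex C (s + i)))) ≡ f (vertex C 0)
        colour i≤m = trans (cong f (In₁-back (in₁ i≤m))) (monochromatic M (bound i≤m))

        stretch-edge : ℕ → E G₁
        stretch-edge i with i <? m
        ... | yes _ = back₁ᴱ (edge C (s + i))
        ... | no _  = e₁′

        stretch-edge-< : ∀ {i} → i < m → stretch-edge i ≡ back₁ᴱ (edge C (s + i))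
        stretch-edge-< {i} i<m with i <? m
        ... | yes _  = refl
        ... | no i≮m = contradiction i<m i≮m

        stretch-edge-m : stretch-edge m ≡ e₁′
        stretch-edge-m with m <? m
        ... | yes m<m = contradiction m<m (<-irrefl refl)
        ... | no _    = refl

        stretch-edge-injective : ∀ {i k} → i ≤ m → k ≤ m → stretch-edge i ≡ stretch-edge k → i ≡ k
        stretch-edge-injective {i} {k} i≤m k≤m eq with m≤n⇒m<n∨m≡n i≤m | m≤n⇒m<n∨m≡n k≤m
        ... | inj₁ i<m  | inj₁ k<m  = +-cancelˡ-≡ s _ _ (edge-injective C (bound i≤m) (bound k≤m)
                                        (back₁ᴱ-injective (G₁-edges i<m) (G₁-edges k<m)
                                          (trans (sym (stretch-edge-< i<m)) (trans eq (stretch-edge-< k<m)))))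
        ... | inj₁ i<m  | inj₂ refl = contradiction (trans (sym (stretch-edge-< i<m)) (trans eq stretch-edge-m))
                                                    (proj₂ (back₁ᴱ-≢ (G₁-edges i<m)))
        ... | inj₂ refl | inj₁ k<m  = contradiction (trans (sym (stretch-edge-< k<m)) (trans (sym eq) stretch-edge-m))
                                                    (proj₂ (back₁ᴱ-≢ (G₁-edges k<m)))
        ... | inj₂ refl | inj₂ refl = refl

        stretch-step : ∀ {i} → i < m →
                       Joins G₁ (stretch-edge i) (back₁ (vertex C (s + i))) (back₁ (vertex C (s + suc i)))
        stretch-step {i} i<m rewrite stretch-edge-< i<m | +-suc s i =
          proj₂ (proj₂ (G₁-edge-ends (G₁-edges i<m) (step C (<-≤-trans (+-monoʳ-< s i<m) s+m≤l))))

        stretch-close : Joins G₁ (stretch-edge m) (back₁ (vertex C (s + m))) (back₁ (vertex C (s + 0)))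
        stretch-close rewrite stretch-edge-m | +-identityʳ s | start | end = closing

        stretch-edge-kept : ∀ {i} → i ≤ m → edges-except G₁ _≟E₁_ e₁ e₁ (stretch-edge i) ≡ true
        stretch-edge-kept {i} i≤m with m≤n⇒m<n∨m≡n i≤m
        ... | inj₁ i<m  rewrite stretch-edge-< i<m = let ≢e₁ , _ = back₁ᴱ-≢ (G₁-edges i<m) in
                                                     edges-except-true G₁ _≟E₁_ e₁ e₁ ≢e₁ ≢e₁
        ... | inj₂ refl rewrite stretch-edge-m =
          edges-except-true G₁ _≟E₁_ e₁ e₁ (e₁≢e₁′ ∘ sym) (e₁≢e₁′ ∘ sym)

      stretch : MonoCircuit G₁ (allV G₁) (edges-except G₁ _≟E₁_ e₁ e₁) (f ∘ inj₁)
      stretch = record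
        { circuit       = record
          { len              = m
          ; len≥1            = 1≤m
          ; vertex           = back₁ ∘ vertex C ∘ (s +_)
          ; edge             = stretch-edge
          ; vertex-injective = λ i≤m k≤m → +-cancelˡ-≡ s _ _ ∘ vertex-injective C (bound i≤m) (bound k≤m)
                                             ∘ back₁-injective (in₁ i≤m) (in₁ k≤m)
          ; edge-injective   = stretch-edge-injective
          ; step             = stretch-step
          ; close            = stretch-close
          }
        ; vertices-in   = λ _ → refl
        ; edges-in      = stretch-edge-kept
        ; monochromatic = λ i≤m → trans (colour i≤m) (sym (colour z≤n))
        }

    private
      present-new-edges-agree : ∀ {e e′} → isNew e ≡ true → isNew e′ ≡ true → F e ≡ true → F e′ ≡ true →
                                e ≡ e′
      present-new-edges-agree new new′ Fe Fe′ with new-edge new | new-edge new′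
      ... | b , refl | b′ , refl =
        cong (inj₂ ∘ inj₂) (trans (Boolₚ.¬-not (≢b₀ Fe)) (sym (Boolₚ.¬-not (≢b₀ Fe′))))
        where
        ≢b₀ : ∀ {c} → F (inj₂ (inj₂ c)) ≡ true → c ≢ b₀
        ≢b₀ Fc refl = contradiction (trans (sym Fc) b₀-deleted) λ ()

    -- The only new edge of the circuit is its last one, so the rest runs from u₂ to u₁ (or back)
    -- and switches from G₂ to G₁ exactly once, at v₁.
    module Last-edge-new (M : MonoCircuit G S F f) (new-last : isNew (edge (circuit M) (len (circuit M))) ≡ true) where

      private
        C = circuit M
        l′ = len C ∸ 1
        side = isG₁ ∘ edge C

        1+l′≡l : suc l′ ≡ len C
        1+l′≡l = m+[n∸m]≡n (len≥1 C)

        l′<l : l′ < len C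
        l′<l = ≤-reflexive 1+l′≡l

        old : ∀ {k} → k < len C → isNew (edge C k) ≡ false
        old k<l = Boolₚ.¬-not λ new → <-irrefl (edge-injective C (<⇒≤ k<l) ≤-refl
                    (present-new-edges-agree new new-last (edges-in M (<⇒≤ k<l)) (edges-in M ≤-refl))) k<l

        first-step : Joins G (edge C 0) (vertex C 0) (vertex C 1)
        first-step = step C (len≥1 C)

        last-step : Joins G (edge C l′) (vertex C (len C)) (vertex C l′)
        last-step = Joins-sym {G} (subst (Joins G (edge C l′) (vertex C l′) ∘ vertex C) 1+l′≡l (step C l′<l))

        Switch = ∃[ q ] q < l′ × Visits-v₁ C (suc q)
                      × (∀ {i} → 0 ≤ i → i ≤ q → side i ≡ side 0)
                      × (∀ {i} → suc q ≤ i → i ≤ l′ → side i ≡ side l′)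

        switch : side 0 ≢ side l′ → Switch
        switch = single-switch C z≤n (<⇒≤ l′<l) (λ _ i≤l′ → old (≤-<-trans i≤l′ l′<l))

      from-u₂-to-u₁ : vertex C 0 ≡ ι₂ u₂ → vertex C (len C) ≡ inj₁ u₁ → ⊥
      from-u₂-to-u₁ start-u₂ end-u₁ = G₁-after-switch (switch sides-differ)
        where
        sl′-G₁ = old-edge-at-G₁-vertex (old l′<l) last-step end-u₁ u₁≢v₁

        sides-differ : side 0 ≢ side l′
        sides-differ s0≡sl′ = contradiction (trans (sym (old-edge-at-u₂ (old (len≥1 C)) first-step start-u₂))
                                                   (trans s0≡sl′ sl′-G₁)) λ ()

        G₁-after-switch : Switch → ⊥
        G₁-after-switch (q , q<l′ , visits , _ , G₁-after) =
          tf₁ (Stretch.stretch M (m<n⇒0<n∸m q<l′) (≤-reflexive q′+m≡l)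
                 (λ i<m → trans (G₁-after (m≤m+n (suc q) _) (<-≤-trans (+-monoʳ-< q i<m) (≤-reflexive q+m≡l′)))
                                sl′-G₁)
                 visits (trans (cong (vertex C) q′+m≡l) end-u₁) e₁′-joins)
          where
          q+m≡l′ = m+[n∸m]≡n (<⇒≤ q<l′)
          q′+m≡l = trans (cong suc q+m≡l′) 1+l′≡l

      from-u₁-to-u₂ : vertex C 0 ≡ inj₁ u₁ → vertex C (len C) ≡ ι₂ u₂ → ⊥
      from-u₁-to-u₂ start-u₁ end-u₂ = G₁-before-switch (switch sides-differ)
        where
        s0-G₁ = old-edge-at-G₁-vertex (old (len≥1 C)) first-step start-u₁ u₁≢v₁

        sides-differ : side 0 ≢ side l′
        sides-differ s0≡sl′ =
          contradiction (trans (sym s0-G₁) (trans s0≡sl′ (old-edge-at-u₂ (old l′<l) last-step end-u₂))) λ ()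

        G₁-before-switch : Switch → ⊥
        G₁-before-switch (q , q<l′ , visits , G₁-before , _) =
          tf₁ (Stretch.stretch M (s≤s z≤n) (<⇒≤ (≤-<-trans q<l′ l′<l))
                 (λ i<q′ → trans (G₁-before z≤n (≤-pred i<q′)) s0-G₁)
                 start-u₁ visits (Joins-sym {G₁} e₁′-joins))

      impossible : ⊥
      impossible with new-edge-ends new-last (close C)
      ... | inj₁ (end-u₁ , start-u₂) = from-u₂-to-u₁ start-u₂ end-u₁
      ... | inj₂ (end-u₂ , start-u₁) = from-u₁-to-u₂ start-u₁ end-u₂

    new-edge-deleted-harmless : NewEdgesHarmless S F f
    new-edge-deleted-harmless M k≤l new with rotate-to-end M k≤l
    ... | M′ , last≡ = Last-edge-new.impossible M′ (trans (cong isNew last≡) new)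

  -- Edges of G₁ and G₂ as edges of the join (junk on the deleted ones).
  private
    lift₁ᴱ′ : (e : E G₁) → Dec (e ≡ e₁) → Dec (e ≡ e₁′) → JE
    lift₁ᴱ′ e (no e≢e₁) (no e≢e₁′) = inj₁ (e , fromWitnessFalse e≢e₁ , fromWitnessFalse e≢e₁′)
    lift₁ᴱ′ e _         _          = inj₂ (inj₂ true)

    lift₂ᴱ′ : (e : E G₂) → Dec (e ≡ e₂) → Dec (e ≡ e₂′) → JE
    lift₂ᴱ′ e (no e≢e₂) (no e≢e₂′) = inj₂ (inj₁ (e , fromWitnessFalse e≢e₂ , fromWitnessFalse e≢e₂′))
    lift₂ᴱ′ e _         _          = inj₂ (inj₂ true)

  lift₁ᴱ : E G₁ → JE
  lift₁ᴱ e = lift₁ᴱ′ e (e ≟E₁ e₁) (e ≟E₁ e₁′)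

  lift₂ᴱ : E G₂ → JE
  lift₂ᴱ e = lift₂ᴱ′ e (e ≟E₂ e₂) (e ≟E₂ e₂′)

  lift₁ᴱ-inj₁ : ∀ {e} (p : False (e ≟E₁ e₁) × False (e ≟E₁ e₁′)) → lift₁ᴱ e ≡ inj₁ (e , p)
  lift₁ᴱ-inj₁ {e} (p , p′) = lift-at (e ≟E₁ e₁) (e ≟E₁ e₁′)
    where
    lift-at : ∀ d d′ → lift₁ᴱ′ e d d′ ≡ inj₁ (e , p , p′)
    lift-at (yes e≡e₁) _          = contradiction e≡e₁ (toWitnessFalse p)
    lift-at (no _)     (yes e≡e₁′) = contradiction e≡e₁′ (toWitnessFalse p′)
    lift-at (no _)     (no _)     =
      cong (λ q → inj₁ (e , q)) (cong₂ _,_ (Boolₚ.T-irrelevant _ _) (Boolₚ.T-irrelevant _ _))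

  lift₂ᴱ-inj₂ : ∀ {e} (p : False (e ≟E₂ e₂) × False (e ≟E₂ e₂′)) → lift₂ᴱ e ≡ inj₂ (inj₁ (e , p))
  lift₂ᴱ-inj₂ {e} (p , p′) = lift-at (e ≟E₂ e₂) (e ≟E₂ e₂′)
    where
    lift-at : ∀ d d′ → lift₂ᴱ′ e d d′ ≡ inj₂ (inj₁ (e , p , p′))
    lift-at (yes e≡e₂) _          = contradiction e≡e₂ (toWitnessFalse p)
    lift-at (no _)     (yes e≡e₂′) = contradiction e≡e₂′ (toWitnessFalse p′)
    lift-at (no _)     (no _)     =
      cong (λ q → inj₂ (inj₁ (e , q))) (cong₂ _,_ (Boolₚ.T-irrelevant _ _) (Boolₚ.T-irrelevant _ _))

  lift₁ : ∀ {j} {f : JV → Fin j} → MonoCircuit G₁ (allV G₁) (edges-except G₁ _≟E₁_ e₁ e₁′) (f ∘ inj₁) →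
          MonoCircuit G (allV G) (allE G) f
  lift₁ M = record
    { circuit       = map-circuit C inj₁ lift₁ᴱ (λ _ _ → inj₁-injective)
                        (λ i≤l k≤l eq → trans (sym (back-lift i≤l)) (trans (cong back₁ᴱ eq) (back-lift k≤l)))
                        (λ {k} k≤l → subst (λ e → Joins G e _ _) (sym (lift₁ᴱ-inj₁ (kept k≤l)))
                                      ∘ Joins-map {G₁} {G} {edge C k} {inj₁ (edge C k , kept k≤l)} inj₁ refl)
    ; vertices-in   = λ _ → refl
    ; edges-in      = λ _ → refl
    ; monochromatic = monochromatic M
    }
    where
    C = circuit M

    kept : ∀ {k} → k ≤ len C → False (edge C k ≟E₁ e₁) × False (edge C k ≟E₁ e₁′)
    kept k≤l with e≢e₁ , e≢e₁′ ← edges-except-true⁻¹ G₁ _≟E₁_ e₁ e₁′ (edges-in M k≤l) =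
      fromWitnessFalse e≢e₁ , fromWitnessFalse e≢e₁′

    back-lift : ∀ {k} → k ≤ len C → back₁ᴱ (lift₁ᴱ (edge C k)) ≡ edge C k
    back-lift k≤l = cong back₁ᴱ (lift₁ᴱ-inj₁ (kept k≤l))

  lift₂ : ∀ {j} {f : JV → Fin j} → MonoCircuit G₂ (allV G₂) (edges-except G₂ _≟E₂_ e₂ e₂′) (f ∘ ι₂) →
          MonoCircuit G (allV G) (allE G) f
  lift₂ M = record
    { circuit       = map-circuit C ι₂ lift₂ᴱ (λ _ _ → ι₂-injective)
                        (λ i≤l k≤l eq → trans (sym (back-lift i≤l)) (trans (cong back₂ᴱ eq) (back-lift k≤l)))
                        (λ {k} k≤l → subst (λ e → Joins G e _ _) (sym (lift₂ᴱ-inj₂ (kept k≤l)))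
                                      ∘ Joins-map {G₂} {G} {edge C k} {inj₂ (inj₁ (edge C k , kept k≤l))} ι₂ refl)
    ; vertices-in   = λ _ → refl
    ; edges-in      = λ _ → refl
    ; monochromatic = monochromatic M
    }
    where
    C = circuit M

    kept : ∀ {k} → k ≤ len C → False (edge C k ≟E₂ e₂) × False (edge C k ≟E₂ e₂′)
    kept k≤l with e≢e₂ , e≢e₂′ ← edges-except-true⁻¹ G₂ _≟E₂_ e₂ e₂′ (edges-in M k≤l) =
      fromWitnessFalse e≢e₂ , fromWitnessFalse e≢e₂′

    back-lift : ∀ {k} → k ≤ len C → back₂ᴱ (lift₂ᴱ (edge C k)) ≡ edge C k
    back-lift k≤l = cong back₂ᴱ (lift₂ᴱ-inj₂ (kept k≤l))

  -- χ₂ of the join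

  -- Align the colours of v₁ and v₂ and separate those of u₁ and u₂, using a third colour.
  join-colourable : ∀ {k} → 3 ≤ k → Colourable G₁ (allV G₁) (allE G₁) k → Colourable G₂ (allV G₂) (allE G₂) k →
                    Colourable G (allV G) (allE G) k
  join-colourable 3≤k col₁ col₂ with totalColouring {F = allE G₁} col₁ | totalColouring {F = allE G₂} col₂
  ... | f₁ , tf₁ | f₂ , tf₂
    with relabelling-sending-avoiding 3≤k
           (parallel-ends-differ e₂-joins e₂′-joins tf₂ u₂≢v₂ e₂≢e₂′ refl refl refl refl) (f₁ u₁) (f₁ v₁)
  ... | π , π-inj , v-aligned , u-separated =
    glue-aligned tf₁ (relabel tf₂ π-inj) v-aligned (λ _ _ → refl) (λ _ _ _ → refl) (λ _ _ → refl) (λ _ _ _ → refl)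
      (harmless-if-u-colours-differ λ _ _ same → u-separated (trans (sym (joint-ι₂ v-aligned u₂)) (sym same)))

  -- If u₁, v₁ get different colours then e₁, e₁′ can be restored in G₁; similarly for G₂;
  -- and they cannot both get equal colours because of the two new edges.
  join-colourable⁻¹ : ∀ {j} → Colourable G (allV G) (allE G) j →
                      Colourable G₁ (allV G₁) (allE G₁) j ⊎ Colourable G₂ (allV G₂) (allE G₂) j
  join-colourable⁻¹ col with totalColouring {F = allE G} col
  ... | f , tf with f (inj₁ u₁) Finₚ.≟ f (inj₁ v₁) | f (ι₂ u₂) Finₚ.≟ f (ι₂ v₂)
  ... | no differ₁ | _ =
    inj₁ (colourable (add-parallel-edges e₁-joins e₁′-joins _≟E₁_ (tf ∘ lift₁)
                                         (λ _ _ → edges-except-true G₁ _≟E₁_ e₁ e₁′) differ₁))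
  ... | yes _ | no differ₂ =
    inj₂ (colourable (add-parallel-edges e₂-joins e₂′-joins _≟E₂_ (tf ∘ lift₂)
                                         (λ _ _ → edges-except-true G₂ _≟E₂_ e₂ e₂′) differ₂))
  ... | yes same₁ | yes same₂ =
    contradiction (trans same₁ (trans (cong f (sym ι₂-v₂)) (sym same₂)))
                  (parallel-ends-differ {G} {a = inj₂ (inj₂ true)} {inj₂ (inj₂ false)} (inj₁ refl) (inj₁ refl) tf
                                        (ι₂-u₂ ∘ sym) (λ ()) refl refl refl refl)

  χ₂-join : ∀ {k} → 3 ≤ k → IsChi₂ G₁ k → IsChi₂ G₂ k → IsChi₂ G k
  χ₂-join 3≤k (col₁ , minimal₁) (col₂ , minimal₂) =
    join-colourable 3≤k col₁ col₂ , λ j col → [ minimal₁ j , minimal₂ j ] (join-colourable⁻¹ col)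

  -- Criticality of the join

  module Criticality (_≟V₁_ : DecidableEquality (V G₁)) {m : ℕ}
                     (critical₁ : Cri₂ G₁ (suc (suc (suc m)))) (critical₂ : Cri₂ G₂ (suc (suc (suc m))))
                     {S : VSub G} {F : ESub G} (sub : IsSubgraph G S F) where

    private
      K = suc (suc m)

      avoid₁ : ∀ {x} → (∀ {z} → S (inj₁ z) ≡ true → z ≢ x) →
               ∀ e → isG₁ e ≡ true → F e ≡ true → edges-avoiding G₁ _≟V₁_ x (back₁ᴱ e) ≡ true
      avoid₁ ≢x (inj₁ (e , _)) _ Fe =
        let Sp , Sq = sub _ Fe in edges-avoiding-true G₁ _≟V₁_ _ (inj₁ refl) (≢x Sp) (≢x Sq)

      avoid₂ : ∀ {y} → (∀ {z} → S (ι₂ z) ≡ true → z ≢ y) →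
               ∀ e → isG₂ e ≡ true → F e ≡ true → edges-avoiding G₂ _≟V₂_ y (back₂ᴱ e) ≡ true
      avoid₂ ≢y (inj₂ (inj₁ (e , _))) _ Fe =
        let Sp , Sq = sub _ Fe in edges-avoiding-true G₂ _≟V₂_ _ (inj₁ refl) (≢y Sp) (≢y Sq)

      G₁-edges-kept : ∀ e → isG₁ e ≡ true → F e ≡ true → edges-except G₁ _≟E₁_ e₁ e₁′ (back₁ᴱ e) ≡ true
      G₁-edges-kept _ G₁-edge _ = let ≢e₁ , ≢e₁′ = back₁ᴱ-≢ G₁-edge in
                                  edges-except-true G₁ _≟E₁_ e₁ e₁′ ≢e₁ ≢e₁′

      G₂-edges-kept : ∀ e → isG₂ e ≡ true → F e ≡ true → edges-except G₂ _≟E₂_ e₂ e₂′ (back₂ᴱ e) ≡ true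
      G₂-edges-kept _ G₂-edge _ = let ≢e₂ , ≢e₂′ = back₂ᴱ-≢ G₂-edge in
                                  edges-except-true G₂ _≟E₂_ e₂ e₂′ ≢e₂ ≢e₂′

      without-edges₁ : ∀ a a′ →
                       Σ[ f ∈ (V G₁ → Fin K) ] IsForestColouring G₁ (allV G₁) (edges-except G₁ _≟E₁_ a a′) f
      without-edges₁ a a′ =
        critical-colouring critical₁ _ _ (edge-deletion-subgraph G₁ _≟E₁_ a a′) (edge-deletion-proper G₁ _≟E₁_ a a′)

      without-edges₂ : ∀ a a′ →
                       Σ[ f ∈ (V G₂ → Fin K) ] IsForestColouring G₂ (allV G₂) (edges-except G₂ _≟E₂_ a a′) f
      without-edges₂ a a′ =
        critical-colouring critical₂ _ _ (edge-deletion-subgraph G₂ _≟E₂_ a a′) (edge-deletion-proper G₂ _≟E₂_ a a′)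

    -- Deleting v₁ frees u₁ and u₂ to take different colours.
    v₁-deleted : S (inj₁ v₁) ≡ false → Colourable G S F K
    v₁-deleted Sv₁
      with critical-colouring critical₁ _ _ (vertex-deletion-subgraph G₁ _≟V₁_ v₁)
                                           (vertex-deletion-proper G₁ _≟V₁_ v₁)
         | critical-colouring critical₂ _ _ (vertex-deletion-subgraph G₂ _≟V₂_ v₂)
                                           (vertex-deletion-proper G₂ _≟V₂_ v₂)
    ... | f₁ , tf₁ | f₂ , tf₂ with relabelling-avoiding (s≤s (s≤s z≤n)) (f₂ u₂) (f₁ u₁)
    ... | π , π-inj , u-separated =
      colourable (glue {f = joint f₁ (π ∘ f₂)} tf₁
                       (recolour (relabel tf₂ π-inj) λ y Sy → joint-ι₂-≢ (vertices-except-true⁻¹ G₂ _≟V₂_ v₂ Sy))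
                       (λ _ → vertices-except-true G₁ _≟V₁_ v₁ ∘ ≢v₁) (avoid₁ ≢v₁)
                       (λ _ → vertices-except-true G₂ _≟V₂_ v₂ ∘ ≢v₂) (avoid₂ ≢v₂)
                       (harmless-if-u-colours-differ λ _ _ same →
                          u-separated (trans (sym (joint-ι₂-≢ u₂≢v₂)) (sym same))))
      where
      ≢v₁ : ∀ {z} → S (inj₁ z) ≡ true → z ≢ v₁
      ≢v₁ Sz refl = contradiction (trans (sym Sz) Sv₁) λ ()

      ≢v₂ : ∀ {z} → S (ι₂ z) ≡ true → z ≢ v₂
      ≢v₂ Sz refl = contradiction (trans (sym Sz) (trans (cong S ι₂-v₂) Sv₁)) λ ()

    -- In G₂ − {e₂, e₂′} the colours of u₂ and v₂ are forced to agree,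
    -- while in G₁ those of u₁ and v₁ differ whenever a new edge survives.
    G₁-part-deleted : ∀ {S₁ F₁} → IsSubgraph G₁ S₁ F₁ → IsProper G₁ S₁ F₁ →
                      (∀ x → S (inj₁ x) ≡ true → S₁ x ≡ true) →
                      (∀ e → isG₁ e ≡ true → F e ≡ true → F₁ (back₁ᴱ e) ≡ true) →
                      (∀ b → F (inj₂ (inj₂ b)) ≡ true →
                         S₁ u₁ ≡ true × S₁ v₁ ≡ true × F₁ e₁ ≡ true × F₁ e₁′ ≡ true) →
                      Colourable G S F K
    G₁-part-deleted sub₁ proper₁ S⊆₁ F⊆₁ keeps-u₁v₁
      with critical-colouring critical₁ _ _ sub₁ proper₁ | without-edges₂ e₂ e₂′
    ... | f₁ , tf₁ | f₂ , tf₂ with relabelling-sending (f₂ v₂) (f₁ v₁)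
    ... | π , π-inj , v-aligned =
      glue-aligned tf₁ (relabel tf₂ π-inj) v-aligned S⊆₁ F⊆₁ (λ _ _ → refl) G₂-edges-kept
                   (harmless-if-u-colours-differ u-separated)
      where
      u₂-like-v₂ : f₂ u₂ ≡ f₂ v₂
      u₂-like-v₂ = parallel-ends-agree (proj₁ critical₂) ≤-refl _≟E₂_ e₂-joins e₂′-joins tf₂

      u-separated : ∀ b → F (inj₂ (inj₂ b)) ≡ true → f₁ u₁ ≢ joint f₁ (π ∘ f₂) (ι₂ u₂)
      u-separated b Fb same with Su₁ , Sv₁ , Fe₁ , Fe₁′ ← keeps-u₁v₁ b Fb =
        parallel-ends-differ e₁-joins e₁′-joins tf₁ u₁≢v₁ e₁≢e₁′ Su₁ Sv₁ Fe₁ Fe₁′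
          (trans same (trans (joint-ι₂ v-aligned u₂) (trans (cong π u₂-like-v₂) v-aligned)))

    G₂-part-deleted : ∀ {S₂ F₂} → IsSubgraph G₂ S₂ F₂ → IsProper G₂ S₂ F₂ →
                      (∀ y → S (ι₂ y) ≡ true → S₂ y ≡ true) →
                      (∀ e → isG₂ e ≡ true → F e ≡ true → F₂ (back₂ᴱ e) ≡ true) →
                      (∀ b → F (inj₂ (inj₂ b)) ≡ true →
                         S₂ u₂ ≡ true × S₂ v₂ ≡ true × F₂ e₂ ≡ true × F₂ e₂′ ≡ true) →
                      Colourable G S F K
    G₂-part-deleted sub₂ proper₂ S⊆₂ F⊆₂ keeps-u₂v₂
      with without-edges₁ e₁ e₁′ | critical-colouring critical₂ _ _ sub₂ proper₂
    ... | f₁ , tf₁ | f₂ , tf₂ with relabelling-sending (f₂ v₂) (f₁ v₁)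
    ... | π , π-inj , v-aligned =
      glue-aligned tf₁ (relabel tf₂ π-inj) v-aligned (λ _ _ → refl) G₁-edges-kept S⊆₂ F⊆₂
                   (harmless-if-u-colours-differ u-separated)
      where
      u₁-like-v₁ : f₁ u₁ ≡ f₁ v₁
      u₁-like-v₁ = parallel-ends-agree (proj₁ critical₁) ≤-refl _≟E₁_ e₁-joins e₁′-joins tf₁

      u-separated : ∀ b → F (inj₂ (inj₂ b)) ≡ true → f₁ u₁ ≢ joint f₁ (π ∘ f₂) (ι₂ u₂)
      u-separated b Fb same with Su₂ , Sv₂ , Fe₂ , Fe₂′ ← keeps-u₂v₂ b Fb =
        parallel-ends-differ e₂-joins e₂′-joins tf₂ u₂≢v₂ e₂≢e₂′ Su₂ Sv₂ Fe₂ Fe₂′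
          (π-inj (trans (sym (joint-ι₂ v-aligned u₂)) (trans (sym same) (trans u₁-like-v₁ (sym v-aligned)))))

    new-edge-deleted : ∀ {b₀} → F (inj₂ (inj₂ b₀)) ≡ false → Colourable G S F K
    new-edge-deleted b₀-deleted
      with without-edges₁ e₁ e₁ | without-edges₂ e₂ e₂′
    ... | f₁ , tf₁ | f₂ , tf₂ with relabelling-sending (f₂ v₂) (f₁ v₁)
    ... | π , π-inj , v-aligned =
      glue-aligned tf₁ (relabel tf₂ π-inj) v-aligned
        (λ _ _ → refl) (λ _ G₁-edge _ → let ≢e₁ , _ = back₁ᴱ-≢ G₁-edge in edges-except-true G₁ _≟E₁_ e₁ e₁ ≢e₁ ≢e₁)
        (λ _ _ → refl) G₂-edges-kept (new-edge-deleted-harmless b₀-deleted tf₁)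

    G₁-vertex-deleted : ∀ {x} → S (inj₁ x) ≡ false → x ≢ v₁ → Colourable G S F K
    G₁-vertex-deleted {x} Sx x≢v₁ =
      G₁-part-deleted (vertex-deletion-subgraph G₁ _≟V₁_ x) (vertex-deletion-proper G₁ _≟V₁_ x)
        (λ _ → vertices-except-true G₁ _≟V₁_ x ∘ ≢x) (avoid₁ ≢x)
        (λ b Fb → let Su₁ = proj₁ (sub _ Fb) in
           vertices-except-true G₁ _≟V₁_ x (≢x Su₁) , vertices-except-true G₁ _≟V₁_ x (x≢v₁ ∘ sym) ,
           edges-avoiding-true G₁ _≟V₁_ x e₁-joins (≢x Su₁) (x≢v₁ ∘ sym) ,
           edges-avoiding-true G₁ _≟V₁_ x e₁′-joins (≢x Su₁) (x≢v₁ ∘ sym))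
      where
      ≢x : ∀ {z} → S (inj₁ z) ≡ true → z ≢ x
      ≢x Sz refl = contradiction (trans (sym Sz) Sx) λ ()

    G₂-vertex-deleted : ∀ {y} (p : False (y ≟V₂ v₂)) → S (inj₂ (y , p)) ≡ false → Colourable G S F K
    G₂-vertex-deleted {y} p Sy =
      G₂-part-deleted (vertex-deletion-subgraph G₂ _≟V₂_ y) (vertex-deletion-proper G₂ _≟V₂_ y)
        (λ _ → vertices-except-true G₂ _≟V₂_ y ∘ ≢y) (avoid₂ ≢y)
        (λ b Fb → let Su₂ = proj₂ (sub _ Fb) in
           vertices-except-true G₂ _≟V₂_ y (≢y Su₂) , vertices-except-true G₂ _≟V₂_ y v₂≢y ,
           edges-avoiding-true G₂ _≟V₂_ y e₂-joins (≢y Su₂) v₂≢y ,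
           edges-avoiding-true G₂ _≟V₂_ y e₂′-joins (≢y Su₂) v₂≢y)
      where
      v₂≢y : v₂ ≢ y
      v₂≢y = toWitnessFalse p ∘ sym

      ≢y : ∀ {z} → S (ι₂ z) ≡ true → z ≢ y
      ≢y Sz refl = contradiction (trans (sym Sz) (trans (cong S (ι₂-distinct p)) Sy)) λ ()

    G₁-edge-deleted : ∀ {e} (p : False (e ≟E₁ e₁) × False (e ≟E₁ e₁′)) → F (inj₁ (e , p)) ≡ false →
                      Colourable G S F K
    G₁-edge-deleted {e} p Fe =
      G₁-part-deleted (edge-deletion-subgraph G₁ _≟E₁_ e e) (edge-deletion-proper G₁ _≟E₁_ e e)
        (λ _ _ → refl) (λ _ G₁-edge Fe′ → edges-except-true G₁ _≟E₁_ e e (≢e G₁-edge Fe′) (≢e G₁-edge Fe′))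
        (λ _ _ → refl , refl , edges-except-true G₁ _≟E₁_ e e e₁≢e e₁≢e ,
                               edges-except-true G₁ _≟E₁_ e e e₁′≢e e₁′≢e)
      where
      ≢e : ∀ {e′} → isG₁ e′ ≡ true → F e′ ≡ true → back₁ᴱ e′ ≢ e
      ≢e G₁-edge Fe′ eq with refl ← back₁ᴱ-injective {e′ = inj₁ (e , p)} G₁-edge refl eq =
        contradiction (trans (sym Fe′) Fe) λ ()

      e₁≢e : e₁ ≢ e
      e₁≢e = toWitnessFalse (proj₁ p) ∘ sym

      e₁′≢e : e₁′ ≢ e
      e₁′≢e = toWitnessFalse (proj₂ p) ∘ sym

    G₂-edge-deleted : ∀ {e} (p : False (e ≟E₂ e₂) × False (e ≟E₂ e₂′)) → F (inj₂ (inj₁ (e , p))) ≡ false →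
                      Colourable G S F K
    G₂-edge-deleted {e} p Fe =
      G₂-part-deleted (edge-deletion-subgraph G₂ _≟E₂_ e e) (edge-deletion-proper G₂ _≟E₂_ e e)
        (λ _ _ → refl) (λ _ G₂-edge Fe′ → edges-except-true G₂ _≟E₂_ e e (≢e G₂-edge Fe′) (≢e G₂-edge Fe′))
        (λ _ _ → refl , refl , edges-except-true G₂ _≟E₂_ e e e₂≢e e₂≢e ,
                               edges-except-true G₂ _≟E₂_ e e e₂′≢e e₂′≢e)
      where
      ≢e : ∀ {e′} → isG₂ e′ ≡ true → F e′ ≡ true → back₂ᴱ e′ ≢ e
      ≢e G₂-edge Fe′ eq with refl ← back₂ᴱ-injective {e′ = inj₂ (inj₁ (e , p))} G₂-edge refl eq =
        contradiction (trans (sym Fe′) Fe) λ ()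

      e₂≢e : e₂ ≢ e
      e₂≢e = toWitnessFalse (proj₁ p) ∘ sym

      e₂′≢e : e₂′ ≢ e
      e₂′≢e = toWitnessFalse (proj₂ p) ∘ sym

    proper-subgraph-colourable : IsProper G S F → Colourable G S F K
    proper-subgraph-colourable (inj₁ (inj₁ x , Sx)) with x ≟V₁ v₁
    ... | yes refl = v₁-deleted Sx
    ... | no x≢v₁  = G₁-vertex-deleted Sx x≢v₁
    proper-subgraph-colourable (inj₁ (inj₂ (_ , p) , Sy))          = G₂-vertex-deleted p Sy
    proper-subgraph-colourable (inj₂ (inj₁ (_ , p) , Fe))          = G₁-edge-deleted p Fe
    proper-subgraph-colourable (inj₂ (inj₂ (inj₁ (_ , p)) , Fe))   = G₂-edge-deleted p Fe
    proper-subgraph-colourable (inj₂ (inj₂ (inj₂ _) , Fb))         = new-edge-deleted Fb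

  enumerable-JV : Finite G₁ → Finite G₂ → Enumerable JV
  enumerable-JV ((_ , V₁↔Fin) , _) ((_ , V₂↔Fin) , _) =
    enumerable-retract (enumerable-⊎ (enumerable-finite V₁↔Fin) (enumerable-finite V₂↔Fin))
                       (mk↩ {to = [ inj₁ , ι₂ ]} {from = from}
                            λ { {inj₁ x} refl → refl ; {inj₂ (y , p)} refl → ι₂-distinct p })
    where
    from : JV → V G₁ ⊎ V G₂
    from (inj₁ x)       = inj₁ x
    from (inj₂ (y , _)) = inj₂ y

  enumerable-JE : Finite G₁ → Finite G₂ → Enumerable JE
  enumerable-JE (_ , (_ , E₁↔Fin)) (_ , (_ , E₂↔Fin)) =
    enumerable-retract
      (enumerable-⊎ (enumerable-finite E₁↔Fin) (enumerable-⊎ (enumerable-finite E₂↔Fin) enumerable-Bool))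
      (mk↩ {to = [ lift₁ᴱ , [ lift₂ᴱ , inj₂ ∘ inj₂ ] ]} {from = from} inverse)
    where
    from : JE → E G₁ ⊎ (E G₂ ⊎ Bool)
    from (inj₁ (e , _))        = inj₁ e
    from (inj₂ (inj₁ (e , _))) = inj₂ (inj₁ e)
    from (inj₂ (inj₂ b))       = inj₂ (inj₂ b)

    inverse : ∀ {e e′} → e′ ≡ from e → [ lift₁ᴱ , [ lift₂ᴱ , inj₂ ∘ inj₂ ] ] e′ ≡ e
    inverse {inj₁ (_ , p)}        refl = lift₁ᴱ-inj₁ p
    inverse {inj₂ (inj₁ (_ , p))} refl = lift₂ᴱ-inj₂ p
    inverse {inj₂ (inj₂ _)}       refl = refl

  critical-join : ∀ {k} → 3 ≤ k → Finite G₁ → Finite G₂ → Cri₂ G₁ k → Cri₂ G₂ k → Cri₂ G k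
  critical-join 3≤k@(s≤s (s≤s (s≤s _))) fin₁ fin₂ critical₁ critical₂ =
    χ₂-join 3≤k (proj₁ critical₁) (proj₁ critical₂) , λ S F sub proper →
      let j , j≤K , χ₂-is-j = Decision.χ₂-exists G (enumerable-JV fin₁ fin₂) (enumerable-JE fin₁ fin₂) S F
                                (Criticality.proper-subgraph-colourable _≟V₁_ critical₁ critical₂ sub proper)
      in j , χ₂-is-j , s≤s j≤K
    where
    _≟V₁_ = Enumeration._≟_ (enumerable-finite (proj₂ (proj₁ fin₁)))

theorem14 : (G₁ G₂ : Graph) → Finite G₁ → Finite G₂ → Loopless G₁ → Loopless G₂ →
    (_≟V₂_ : DecidableEquality (V G₂)) →
    (_≟E₁_ : DecidableEquality (E G₁)) →
    (_≟E₂_ : DecidableEquality (E G₂)) →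
    (u₁ v₁ : V G₁) → u₁ ≢ v₁ → (e₁ e₁' : E G₁) → e₁ ≢ e₁' →
    Joins G₁ e₁ u₁ v₁ → Joins G₁ e₁' u₁ v₁ →
    (u₂ v₂ : V G₂) → u₂ ≢ v₂ → (e₂ e₂' : E G₂) → e₂ ≢ e₂' →
    Joins G₂ e₂ u₂ v₂ → Joins G₂ e₂' u₂ v₂ →
    ((k : ℕ) → 3 ≤ k → IsChi₂ G₁ k → IsChi₂ G₂ k →
       IsChi₂ (HajosJoin.join G₁ G₂ _≟V₂_ _≟E₁_ _≟E₂_ u₁ v₁ e₁ e₁' u₂ v₂ e₂ e₂') k)
    × ((k : ℕ) → 3 ≤ k → Cri₂ G₁ k → Cri₂ G₂ k →
       Cri₂ (HajosJoin.join G₁ G₂ _≟V₂_ _≟E₁_ _≟E₂_ u₁ v₁ e₁ e₁' u₂ v₂ e₂ e₂') k)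
theorem14 G₁ G₂ fin₁ fin₂ _ _ _≟V₂_ _≟E₁_ _≟E₂_
          u₁ v₁ u₁≢v₁ e₁ e₁′ e₁≢e₁′ e₁-joins e₁′-joins u₂ v₂ u₂≢v₂ e₂ e₂′ e₂≢e₂′ e₂-joins e₂′-joins =
  (λ _ → χ₂-join) , λ _ 3≤k → critical-join 3≤k fin₁ fin₂
  where
  open Hajós G₁ G₂ _≟V₂_ _≟E₁_ _≟E₂_ u₁ v₁ u₁≢v₁ e₁ e₁′ e₁≢e₁′ e₁-joins e₁′-joins
                                     u₂ v₂ u₂≢v₂ e₂ e₂′ e₂≢e₂′ e₂-joins e₂′-joins
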